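{- Let $n\ge4$. For each pseudo-composition $\alpha$ of $n$, \[ r^D_\alpha=\sum_{\beta\preccurlyeq\alpha}(-1)^{\ell(\alpha)-\ell(\beta)}\,\nu(\beta), \] where the sum runs over pseudo-compositions $\beta=(\beta_1,\ldots,\beta_\ell)$ of $n$ with $D(\beta)\subseteq D(\alpha)$, and \[ \nu(\beta):=\begin{cases} 2^{n-1}\binom{n}{\beta_1,\ldots,\beta_\ell}, & \beta_1=0,\\ 2^{n-1}\binom{n}{1+\beta_2,\beta_3,\ldots,\beta_\ell}, & \beta_1=1,\\ 2^{n-\beta_1}\binom{n}{\beta_1,\ldots,\beta_\ell}, & 1<\beta_1\le n.\end{cases} \]
   Context: A signed permutation of $[n]$ is a bijection $w$ of $\{\pm1,\ldots,\pm n\}$ with $w(-i)=-w(i)$; it is even if an even number of $w(1),\ldots,w(n)$ are negative; even signed permutations form the group $\mathfrak{S}^D_n$. With the convention $w(0):=-w(2)$, $D(w)=\{i\in\{0,\ldots,n-1\}: w(i)>w(i+1)\}$. A pseudo-composition of $n$ is a sequence $(\alpha_1,\ldots,\alpha_\ell)$ of integers with $\alpha_1\ge0$, $\alpha_2,\ldots,\alpha_\ell>0$, sum $n$; $\ell(\alpha)=\ell$, $D(\alpha)=\{\alpha_1,\ldots,\alpha_1+\cdots+\alpha_{\ell-1}\}$. $r^D_\alpha=|\{w\in\mathfrak{S}^D_n: D(w)=D(\alpha)\}|$. Multinomial coefficients are $m!/(m_1!\cdots m_r!)$ when the parts sum to $m$. -}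

module Defs where

open import Data.Nat as ℕ using (ℕ; zero; suc; _+_; _*_; _∸_; _^_; _!; _/_; NonZero)
open import Data.Nat.Properties as ℕP using (m*n≢0; _!≢0)
open import Data.Nat.Divisibility using (_∣_; _∣?_)
open import Data.Integer as ℤ using (ℤ; +_; -[1+_]; -_; ∣_∣)
import Data.Integer.Properties as ℤP
open import Data.List using (List; []; _∷_; length; map; filter; concatMap; upTo; foldr; drop; _++_)
open import Data.Nat.ListAction using (sum)
open import Data.List.Relation.Unary.All using (All)
open import Data.List.Relation.Unary.All.Properties using ()
import Data.List.Relation.Unary.All as All
open import Data.List.Relation.Unary.AllPairs using (AllPairs)
import Data.List.Relation.Unary.AllPairs as AllPairs
open import Data.List.Membership.Propositional using (_∈_)
open import Data.List.Membership.DecPropositional ℕ._≟_ using (_∈?_)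
open import Data.Product using (_×_)
open import Relation.Nullary using (Dec; ¬_)
open import Relation.Nullary.Decidable using (_×-dec_; _→-dec_; ¬?)
open import Relation.Binary.PropositionalEquality using (_≡_; _≢_)

allLists : {A : Set} → List A → ℕ → List (List A)
allLists xs zero    = [] ∷ []
allLists xs (suc k) = concatMap (λ x → map (x ∷_) (allLists xs k)) xs

-- A signed permutation w (w(-i) = -w(i)) is determined by the list
-- w(1), …, w(n) of integers; it is a bijection of {±1,…,±n} iff the
-- entries are nonzero, have absolute value ≤ n, and have pairwise
-- distinct absolute values.

IsSignedPerm : ℕ → List ℤ → Set
IsSignedPerm n w =
  length w ≡ n
  × All (λ x → 1 ℕ.≤ ∣ x ∣ × ∣ x ∣ ℕ.≤ n) w
  × AllPairs (λ x y → ∣ x ∣ ≢ ∣ y ∣) w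

isSignedPerm? : ∀ n w → Dec (IsSignedPerm n w)
isSignedPerm? n w =
  (length w ℕ.≟ n)
  ×-dec All.all? (λ x → (1 ℕ.≤? ∣ x ∣) ×-dec (∣ x ∣ ℕ.≤? n)) w
  ×-dec AllPairs.allPairs? (λ x y → ¬? (∣ x ∣ ℕ.≟ ∣ y ∣)) w

negCount : List ℤ → ℕ
negCount w = length (filter (λ x → x ℤP.<? + 0) w)

IsEven : List ℤ → Set
IsEven w = 2 ∣ negCount w

isEven? : ∀ w → Dec (IsEven w)
isEven? w = 2 ∣? negCount w

-- w(i) for i ≥ 1 is the i-th entry of the list (1-indexed);
-- convention w(0) := -w(2)
entry : List ℤ → ℕ → ℤ
entry []      _       = + 0
entry (x ∷ w) zero    = x
entry (x ∷ w) (suc k) = entry w k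

val : List ℤ → ℕ → ℤ
val w zero    = - entry w 1
val w (suc i) = entry w i

IsDescent : List ℤ → ℕ → Set
IsDescent w i = val w (suc i) ℤ.< val w i

isDescent? : ∀ w i → Dec (IsDescent w i)
isDescent? w i = val w (suc i) ℤP.<? val w i

IsPseudoComposition : ℕ → List ℕ → Set
IsPseudoComposition n α =
  1 ℕ.≤ length α × All (λ a → 0 ℕ.< a) (drop 1 α) × sum α ≡ n

isPseudoComposition? : ∀ n α → Dec (IsPseudoComposition n α)
isPseudoComposition? n α =
  (1 ℕ.≤? length α) ×-dec All.all? (λ a → 0 ℕ.<? a) (drop 1 α) ×-dec (sum α ℕ.≟ n)

partialSums : ℕ → List ℕ → List ℕ
partialSums s []       = []
partialSums s (b ∷ bs) = s ∷ partialSums (s + b) bs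

DesSet : List ℕ → List ℕ
DesSet []      = []
DesSet (a ∷ as) = partialSums a as

DesEq : ℕ → List ℤ → List ℕ → Set
DesEq n w α = All (λ i → (IsDescent w i → i ∈ DesSet α) × (i ∈ DesSet α → IsDescent w i)) (upTo n)

desEq? : ∀ n w α → Dec (DesEq n w α)
desEq? n w α = All.all? (λ i → (isDescent? w i →-dec (i ∈? DesSet α)) ×-dec ((i ∈? DesSet α) →-dec isDescent? w i)) (upTo n)

intRange : ℕ → List ℤ
intRange n = map +_ (upTo (suc n)) ++ map -[1+_] (upTo n)

rD : ℕ → List ℕ → ℕ
rD n α = length (filter (λ w → isSignedPerm? n w ×-dec isEven? w ×-dec desEq? n w α)
                        (allLists (intRange n) n))

prodFact : List ℕ → ℕ
prodFact []       = 1
prodFact (m ∷ ms) = m ! * prodFact ms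

prodFact-nonZero : ∀ ms → NonZero (prodFact ms)
prodFact-nonZero []       = _
prodFact-nonZero (m ∷ ms) = m*n≢0 (m !) (prodFact ms) {{m !≢0}} {{prodFact-nonZero ms}}

multinomial : ℕ → List ℕ → ℕ
multinomial m ms = (m ! / prodFact ms) {{prodFact-nonZero ms}}

-- ν(β)  (for a pseudo-composition β of n; the [] and (1) cases cannot
-- occur for pseudo-compositions of n ≥ 4 and are given junk values)

nu : ℕ → List ℕ → ℕ
nu n []                  = 0
nu n (zero ∷ bs)         = 2 ^ (n ∸ 1) * multinomial n (zero ∷ bs)
nu n (suc zero ∷ [])     = 2 ^ (n ∸ 1) * multinomial n (suc zero ∷ [])
nu n (suc zero ∷ b ∷ bs) = 2 ^ (n ∸ 1) * multinomial n (suc b ∷ bs)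
nu n (suc (suc a) ∷ bs)  = 2 ^ (n ∸ suc (suc a)) * multinomial n (suc (suc a) ∷ bs)

-- candidate lists for pseudo-compositions of n: lengths 0..n+1, entries 0..n
-- (every pseudo-composition of n has length ≤ n+1 and entries ≤ n)
candidates : ℕ → List (List ℕ)
candidates n = concatMap (allLists (upTo (suc n))) (upTo (n + 2))

belowPC : ℕ → List ℕ → List (List ℕ)
belowPC n α = filter (λ β → isPseudoComposition? n β ×-dec All.all? (λ d → d ∈? DesSet α) (DesSet β))
                     (candidates n)

sumℤ : List ℤ → ℤ
sumℤ = foldr ℤ._+_ (+ 0)

rhs : ℕ → List ℕ → ℤ
rhs n α = sumℤ (map (λ β → (ℤ.-1ℤ ℤ.^ (length α ∸ length β)) ℤ.* + nu n β) (belowPC n α))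

-- Write N(S) for the number of even signed permutations w with D(w) ⊆ S.  Möbius inversion on
-- the Boolean lattice of subsets of {0,…,n-1} gives r^D_α = Σ_{β ≼ α} (-1)^{ℓ(α)-ℓ(β)} N(D(β)),
-- so everything reduces to N(D(β)) = ν(β).  Exchanging 1 and -1 in w flips its parity and, for
-- n ≥ 2, preserves D(w); hence N(D(β)) is half the number of all signed permutations with
-- D(w) ⊆ D(β).  Those are the w for which 0, w(1), …, w(n) is increasing on blocks determined by β
-- (for β₁ ≥ 2 up to the sign of w(1); β₁ = 1 reduces to β₁ = 0 by negating w(1)), and they are
-- counted by removing the entry ±n, which must end (+n) or start (-n) its block: the resulting
-- recurrence is solved by 2^(number of entries outside the first block) times a multinomial.

module Submission where

open import Data.Bool using (Bool; true; false; if_then_else_; _∧_; _∨_; not)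
import Data.Bool as B
open import Data.Bool.Properties using (∧-assoc; ∧-zeroʳ; ∨-zeroʳ; ∨-identityʳ)
open import Data.Empty using (⊥; ⊥-elim)
open import Data.Integer as ℤ using (ℤ; +_; -[1+_]; ∣_∣)
import Data.Integer.Properties as ℤP
open import Data.List using (List; []; _∷_; length; map; replicate; filter; concatMap; upTo; applyUpTo; take; drop; _++_)
import Data.List.Properties as LP
open import Data.List.Membership.Propositional using (_∈_)
open import Data.List.Membership.Propositional.Properties using (∈-upTo⁺; ∈-upTo⁻)
open import Data.List.Relation.Unary.All using (All; []; _∷_)
open import Data.List.Relation.Unary.All.Properties using (++⁺; map⁺; take⁺; drop⁺)
import Data.List.Relation.Unary.All as All
open import Data.List.Relation.Unary.AllPairs using (AllPairs; []; _∷_)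
open import Data.List.Relation.Unary.Any using (here; there)
open import Data.Maybe using (Maybe; just; nothing)
import Data.Maybe as Maybe
open import Data.Nat as ℕ using (ℕ; zero; suc; _+_; _*_; _∸_; _^_; _≤_; _<_; z≤n; s≤s; _<ᵇ_; _≡ᵇ_; _!; _/_)
open import Data.List.Membership.DecPropositional ℕ._≟_ using (_∈?_)
import Data.Nat.DivMod as ℕ
import Data.Nat.Divisibility as Div
open import Data.Nat.ListAction using (sum)
import Data.Nat.Properties as ℕP
open import Data.Nat.Properties using (+-comm; +-assoc; *-comm; *-assoc; +-identityʳ; *-zeroʳ; *-identityʳ)
open import Data.Nat.Tactic.RingSolver using (solve-∀)
open import Algebra.Properties.CommutativeSemigroup ℕP.+-commutativeSemigroup using () renaming (interchange to +-interchange)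
open import Algebra.Properties.CommutativeSemigroup ℤP.+-commutativeSemigroup using () renaming (interchange to ℤ+-interchange)
open import Data.Product using (_×_; _,_; proj₁; proj₂; ∃)
open import Data.Sum using (_⊎_; inj₁; inj₂)
open import Relation.Binary.Definitions using (DecidableEquality)
open import Relation.Binary.PropositionalEquality
open import Relation.Nullary using (Dec; yes; no; ¬_; does; _×-dec_)
open import Relation.Nullary.Decidable using (dec-true; dec-false)

open import Defs


Σ : {A : Set} → List A → (A → ℕ) → ℕ
Σ []       f = 0
Σ (x ∷ xs) f = f x + Σ xs f

Σℤ : {A : Set} → List A → (A → ℤ) → ℤ
Σℤ xs f = sumℤ (map f xs)

ind : {P : Set} → Dec P → ℕ
ind (yes _) = 1
ind (no _)  = 0

ind-yes : {P : Set} (p : Dec P) → P → ind p ≡ 1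
ind-yes (yes _) _ = refl
ind-yes (no ¬p) x = ⊥-elim (¬p x)

ind-no : {P : Set} (p : Dec P) → ¬ P → ind p ≡ 0
ind-no (yes x) ¬p = ⊥-elim (¬p x)
ind-no (no _)  _  = refl

ind-⇔ : {P Q : Set} (p : Dec P) (q : Dec Q) → (P → Q) → (Q → P) → ind p ≡ ind q
ind-⇔ (yes x) q f g = sym (ind-yes q (f x))
ind-⇔ (no ¬x) q f g = sym (ind-no q (λ y → ¬x (g y)))

ind-× : {P Q : Set} (p : Dec P) (q : Dec Q) → ind (p ×-dec q) ≡ ind p * ind q
ind-× (yes _) (yes _) = refl
ind-× (yes _) (no _)  = refl
ind-× (no _)  _       = refl

does-true⁻ : {P : Set} (p : Dec P) → does p ≡ true → P
does-true⁻ (yes x) _ = x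
does-true⁻ (no _) ()

Σ-cong : {A : Set} (xs : List A) {f g : A → ℕ} → (∀ x → x ∈ xs → f x ≡ g x) → Σ xs f ≡ Σ xs g
Σ-cong []       h = refl
Σ-cong (x ∷ xs) h = cong₂ _+_ (h x (here refl)) (Σ-cong xs (λ y m → h y (there m)))

Σ-ext : {A : Set} (xs : List A) {f g : A → ℕ} → (∀ x → f x ≡ g x) → Σ xs f ≡ Σ xs g
Σ-ext xs h = Σ-cong xs (λ x _ → h x)

Σ-congᴬ : {A : Set} {P : A → Set} (xs : List A) {f g : A → ℕ} → All P xs → (∀ x → P x → f x ≡ g x) → Σ xs f ≡ Σ xs g
Σ-congᴬ [] [] h = refl
Σ-congᴬ (x ∷ xs) (p ∷ ps) h = cong₂ _+_ (h x p) (Σ-congᴬ xs ps h)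

Σ-zero : {A : Set} (xs : List A) {f : A → ℕ} → (∀ x → x ∈ xs → f x ≡ 0) → Σ xs f ≡ 0
Σ-zero []       h = refl
Σ-zero (x ∷ xs) h rewrite h x (here refl) = Σ-zero xs (λ y m → h y (there m))

Σ-+ : {A : Set} (xs : List A) (f g : A → ℕ) → Σ xs (λ x → f x + g x) ≡ Σ xs f + Σ xs g
Σ-+ []       f g = refl
Σ-+ (x ∷ xs) f g rewrite Σ-+ xs f g = +-interchange (f x) (g x) (Σ xs f) (Σ xs g)

Σ-*ˡ : {A : Set} (xs : List A) (c : ℕ) (f : A → ℕ) → Σ xs (λ x → c * f x) ≡ c * Σ xs f
Σ-*ˡ []       c f = sym (*-zeroʳ c)
Σ-*ˡ (x ∷ xs) c f rewrite Σ-*ˡ xs c f = sym (ℕP.*-distribˡ-+ c (f x) (Σ xs f))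

Σ-*ʳ : {A : Set} (xs : List A) (f : A → ℕ) (c : ℕ) → Σ xs (λ x → f x * c) ≡ Σ xs f * c
Σ-*ʳ xs f c = trans (Σ-ext xs (λ x → *-comm (f x) c)) (trans (Σ-*ˡ xs c f) (*-comm c (Σ xs f)))

Σ-swap : {A B : Set} (xs : List A) (ys : List B) (f : A → B → ℕ) →
         Σ xs (λ x → Σ ys (f x)) ≡ Σ ys (λ y → Σ xs (λ x → f x y))
Σ-swap []       ys f = sym (Σ-zero ys (λ _ _ → refl))
Σ-swap (x ∷ xs) ys f rewrite Σ-swap xs ys f = sym (Σ-+ ys (f x) (λ y → Σ xs (λ x' → f x' y)))

Σ-++ : {A : Set} (xs ys : List A) (f : A → ℕ) → Σ (xs ++ ys) f ≡ Σ xs f + Σ ys f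
Σ-++ []       ys f = refl
Σ-++ (x ∷ xs) ys f rewrite Σ-++ xs ys f = sym (+-assoc (f x) (Σ xs f) (Σ ys f))

Σ-map : {A B : Set} (g : A → B) (xs : List A) (f : B → ℕ) → Σ (map g xs) f ≡ Σ xs (λ x → f (g x))
Σ-map g []       f = refl
Σ-map g (x ∷ xs) f = cong (_+_ (f (g x))) (Σ-map g xs f)

Σ-concatMap : {A B : Set} (g : A → List B) (xs : List A) (f : B → ℕ) →
              Σ (concatMap g xs) f ≡ Σ xs (λ x → Σ (g x) f)
Σ-concatMap g []       f = refl
Σ-concatMap g (x ∷ xs) f rewrite Σ-++ (g x) (concatMap g xs) f = cong (_+_ (Σ (g x) f)) (Σ-concatMap g xs f)

length-filter : {A : Set} {P : A → Set} (P? : ∀ x → Dec (P x)) (xs : List A) →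
                length (filter P? xs) ≡ Σ xs (λ x → ind (P? x))
length-filter P? []       = refl
length-filter P? (x ∷ xs) with P? x
... | yes _ = cong suc (length-filter P? xs)
... | no  _ = length-filter P? xs

Σℤ-filter : {A : Set} {P : A → Set} (P? : ∀ x → Dec (P x)) (xs : List A) (f : A → ℤ) →
  Σℤ (filter P? xs) f ≡ Σℤ xs (λ x → if does (P? x) then f x else + 0)
Σℤ-filter P? []       f = refl
Σℤ-filter P? (x ∷ xs) f with P? x
... | yes _ = cong (ℤ._+_ (f x)) (Σℤ-filter P? xs f)
... | no  _ = trans (Σℤ-filter P? xs f) (sym (ℤP.+-identityˡ _))

Σℤ-cong : {A : Set} (xs : List A) {f g : A → ℤ} → (∀ x → x ∈ xs → f x ≡ g x) → Σℤ xs f ≡ Σℤ xs g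
Σℤ-cong []       h = refl
Σℤ-cong (x ∷ xs) h = cong₂ ℤ._+_ (h x (here refl)) (Σℤ-cong xs (λ y m → h y (there m)))

Σℤ-ext : {A : Set} (xs : List A) {f g : A → ℤ} → (∀ x → f x ≡ g x) → Σℤ xs f ≡ Σℤ xs g
Σℤ-ext xs h = Σℤ-cong xs (λ x _ → h x)

Σℤ-zero : {A : Set} (xs : List A) → Σℤ xs (λ _ → + 0) ≡ + 0
Σℤ-zero []       = refl
Σℤ-zero (x ∷ xs) = trans (ℤP.+-identityˡ _) (Σℤ-zero xs)

Σℤ-+ : {A : Set} (xs : List A) (f g : A → ℤ) → Σℤ xs (λ x → f x ℤ.+ g x) ≡ Σℤ xs f ℤ.+ Σℤ xs g
Σℤ-+ []       f g = refl
Σℤ-+ (x ∷ xs) f g rewrite Σℤ-+ xs f g = ℤ+-interchange (f x) (g x) (Σℤ xs f) (Σℤ xs g)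

Σℤ-swap : {A B : Set} (xs : List A) (ys : List B) (f : A → B → ℤ) →
         Σℤ xs (λ x → Σℤ ys (f x)) ≡ Σℤ ys (λ y → Σℤ xs (λ x → f x y))
Σℤ-swap []       ys f = sym (Σℤ-zero ys)
Σℤ-swap (x ∷ xs) ys f rewrite Σℤ-swap xs ys f = sym (Σℤ-+ ys (f x) (λ y → Σℤ xs (λ x' → f x' y)))

Σℤ-*ˡ : {A : Set} (xs : List A) (c : ℤ) (f : A → ℤ) → Σℤ xs (λ x → c ℤ.* f x) ≡ c ℤ.* Σℤ xs f
Σℤ-*ˡ []       c f = sym (ℤP.*-zeroʳ c)
Σℤ-*ˡ (x ∷ xs) c f rewrite Σℤ-*ˡ xs c f = sym (ℤP.*-distribˡ-+ c (f x) (Σℤ xs f))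

Σℤ-++ : {A : Set} (xs ys : List A) (f : A → ℤ) → Σℤ (xs ++ ys) f ≡ Σℤ xs f ℤ.+ Σℤ ys f
Σℤ-++ []       ys f = sym (ℤP.+-identityˡ _)
Σℤ-++ (x ∷ xs) ys f rewrite Σℤ-++ xs ys f = sym (ℤP.+-assoc (f x) (Σℤ xs f) (Σℤ ys f))

Σℤ-map : {A B : Set} (g : A → B) (xs : List A) (f : B → ℤ) → Σℤ (map g xs) f ≡ Σℤ xs (λ x → f (g x))
Σℤ-map g []       f = refl
Σℤ-map g (x ∷ xs) f = cong (ℤ._+_ (f (g x))) (Σℤ-map g xs f)

Σℤ-concatMap : {A B : Set} (g : A → List B) (xs : List A) (f : B → ℤ) →
              Σℤ (concatMap g xs) f ≡ Σℤ xs (λ x → Σℤ (g x) f)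
Σℤ-concatMap g []       f = refl
Σℤ-concatMap g (x ∷ xs) f rewrite Σℤ-++ (g x) (concatMap g xs) f = cong (ℤ._+_ (Σℤ (g x) f)) (Σℤ-concatMap g xs f)

pos-Σ : {A : Set} (xs : List A) (f : A → ℕ) → + Σ xs f ≡ Σℤ xs (λ x → + f x)
pos-Σ []       f = refl
pos-Σ (x ∷ xs) f = trans (ℤP.pos-+ (f x) (Σ xs f)) (cong (ℤ._+_ (+ f x)) (pos-Σ xs f))

ifℤ : {P : Set} → Dec P → ℤ → ℤ
ifℤ p x = if does p then x else + 0

ifℤ-yes : {P : Set} (p : Dec P) (x : ℤ) → P → ifℤ p x ≡ x
ifℤ-yes (yes _) x _ = refl
ifℤ-yes (no ¬p) x q = ⊥-elim (¬p q)

ifℤ-no : {P : Set} (p : Dec P) (x : ℤ) → ¬ P → ifℤ p x ≡ + 0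
ifℤ-no (yes q) x ¬p = ⊥-elim (¬p q)
ifℤ-no (no _) x _ = refl

ifℤ-ind : {P : Set} (p : Dec P) (x : ℤ) → ifℤ p x ≡ + ind p ℤ.* x
ifℤ-ind (yes _) x = sym (ℤP.*-identityˡ x)
ifℤ-ind (no _) x = refl

ifℤ-× : {P Q : Set} (p : Dec P) (q : Dec Q) (x : ℤ) → ifℤ (p ×-dec q) x ≡ ifℤ p (ifℤ q x)
ifℤ-× (yes _) (yes _) x = refl
ifℤ-× (yes _) (no _)  x = refl
ifℤ-× (no _)  _       x = refl

Σℤ-ifℤ-const : {A : Set} {P : A → Set} (p : ∀ a → Dec (P a)) (xs : List A) (x : ℤ) →
  Σℤ xs (λ a → ifℤ (p a) x) ≡ + Σ xs (λ a → ind (p a)) ℤ.* x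
Σℤ-ifℤ-const p xs x = begin
    Σℤ xs (λ a → ifℤ (p a) x)
  ≡⟨ Σℤ-ext xs (λ a → trans (ifℤ-ind (p a) x) (ℤP.*-comm (+ ind (p a)) x)) ⟩
    Σℤ xs (λ a → x ℤ.* + ind (p a))
  ≡⟨ Σℤ-*ˡ xs x (λ a → + ind (p a)) ⟩
    x ℤ.* Σℤ xs (λ a → + ind (p a))
  ≡⟨ cong (x ℤ.*_) (sym (pos-Σ xs (λ a → ind (p a)))) ⟩
    x ℤ.* + Σ xs (λ a → ind (p a))
  ≡⟨ ℤP.*-comm x _ ⟩
    + Σ xs (λ a → ind (p a)) ℤ.* x ∎
  where open ≡-Reasoning


allLists-length : {A : Set} (xs : List A) (k : ℕ) → All (λ w → length w ≡ k) (allLists xs k)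
allLists-length xs zero    = refl ∷ []
allLists-length xs (suc k) = go xs
  where
  go : ∀ ys → All (λ w → length w ≡ suc k) (concatMap (λ x → map (x ∷_) (allLists xs k)) ys)
  go []       = []
  go (y ∷ ys) = ++⁺ (map⁺ (All.map (cong suc) (allLists-length xs k))) (go ys)

Σ-allLists-cong : {A : Set} (xs : List A) (k : ℕ) {f g : List A → ℕ} →
  (∀ w → length w ≡ k → f w ≡ g w) → Σ (allLists xs k) f ≡ Σ (allLists xs k) g
Σ-allLists-cong xs k h = Σ-cong (allLists xs k) (λ w m → h w (All.lookup (allLists-length xs k) m))

Σℤ-allLists-cong : {A : Set} (xs : List A) (k : ℕ) {f g : List A → ℤ} →
  (∀ w → length w ≡ k → f w ≡ g w) → Σℤ (allLists xs k) f ≡ Σℤ (allLists xs k) g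
Σℤ-allLists-cong xs k h = Σℤ-cong (allLists xs k) (λ w m → h w (All.lookup (allLists-length xs k) m))

Σ-allLists-suc : {A : Set} (xs : List A) (k : ℕ) (f : List A → ℕ) →
  Σ (allLists xs (suc k)) f ≡ Σ xs (λ x → Σ (allLists xs k) (λ w → f (x ∷ w)))
Σ-allLists-suc xs k f rewrite Σ-concatMap (λ x → map (x ∷_) (allLists xs k)) xs f =
  Σ-ext xs (λ x → Σ-map (x ∷_) (allLists xs k) f)

Σℤ-allLists-suc : {A : Set} (xs : List A) (k : ℕ) (f : List A → ℤ) →
  Σℤ (allLists xs (suc k)) f ≡ Σℤ xs (λ x → Σℤ (allLists xs k) (λ w → f (x ∷ w)))
Σℤ-allLists-suc xs k f = trans (Σℤ-concatMap (λ x → map (x ∷_) (allLists xs k)) xs f)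
  (Σℤ-ext xs (λ x → Σℤ-map (x ∷_) (allLists xs k) f))

module Multiplicity {A : Set} (_≟_ : DecidableEquality A) where
  _≟*_ : DecidableEquality (List A)
  _≟*_ = LP.≡-dec _≟_

  count : List A → A → ℕ
  count xs x = Σ xs (λ y → ind (y ≟ x))

  ind-∷ : ∀ y w x v → ind ((y ∷ w) ≟* (x ∷ v)) ≡ ind (y ≟ x) * ind (w ≟* v)
  ind-∷ y w x v = trans (ind-⇔ _ ((y ≟ x) ×-dec (w ≟* v)) LP.∷-injective (λ (p , q) → cong₂ _∷_ p q))
                        (ind-× (y ≟ x) (w ≟* v))

  Σ-allLists-δ : ∀ xs k v → All (λ x → count xs x ≡ 1) v →
    Σ (allLists xs k) (λ w → ind (w ≟* v)) ≡ ind (length v ℕ.≟ k)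
  Σ-allLists-δ xs zero [] _ = refl
  Σ-allLists-δ xs zero (x ∷ v) _ = refl
  Σ-allLists-δ xs (suc k) [] _ =
    trans (Σ-allLists-suc xs k _) (Σ-zero xs (λ y _ → Σ-zero (allLists xs k) (λ w _ → refl)))
  Σ-allLists-δ xs (suc k) (x ∷ v) (c ∷ cs) = begin
      Σ (allLists xs (suc k)) (λ w → ind (w ≟* (x ∷ v)))
    ≡⟨ Σ-allLists-suc xs k _ ⟩
      Σ xs (λ y → Σ (allLists xs k) (λ w → ind ((y ∷ w) ≟* (x ∷ v))))
    ≡⟨ Σ-ext xs (λ y → trans (Σ-ext (allLists xs k) (λ w → ind-∷ y w x v))
                              (Σ-*ˡ (allLists xs k) (ind (y ≟ x)) (λ w → ind (w ≟* v)))) ⟩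
      Σ xs (λ y → ind (y ≟ x) * Σ (allLists xs k) (λ w → ind (w ≟* v)))
    ≡⟨ Σ-ext xs (λ y → trans (cong (ind (y ≟ x) *_) (Σ-allLists-δ xs k v cs)) (*-comm (ind (y ≟ x)) _)) ⟩
      Σ xs (λ y → ind (length v ℕ.≟ k) * ind (y ≟ x))
    ≡⟨ Σ-*ˡ xs (ind (length v ℕ.≟ k)) (λ y → ind (y ≟ x)) ⟩
      ind (length v ℕ.≟ k) * count xs x
    ≡⟨ trans (cong (ind (length v ℕ.≟ k) *_) c) (*-identityʳ _) ⟩
      ind (length v ℕ.≟ k)
    ≡⟨ ind-⇔ (length v ℕ.≟ k) (suc (length v) ℕ.≟ suc k) (cong suc) ℕP.suc-injective ⟩
      ind (length (x ∷ v) ℕ.≟ suc k) ∎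
    where open ≡-Reasoning

module Countℕ = Multiplicity ℕ._≟_
module Countℤ = Multiplicity ℤ._≟_

count-upTo : ∀ m x → Countℕ.count (upTo m) x ≡ ind (x ℕ.<? m)
count-upTo zero x = refl
count-upTo (suc m) x =
  trans (cong (λ l → Countℕ.count l x) (sym (LP.upTo-∷ʳ m)))
  (trans (Σ-++ (upTo m) (m ∷ []) (λ y → ind (y ℕ.≟ x)))
  (trans (cong (λ z → z + (ind (m ℕ.≟ x) + 0)) (count-upTo m x)) (last (x ℕ.<? m) (m ℕ.≟ x))))
  where
  last : (p : Dec (x < m)) (q : Dec (m ≡ x)) → ind p + (ind q + 0) ≡ ind (x ℕ.<? suc m)
  last (yes p) (yes refl) = ⊥-elim (ℕP.<-irrefl refl p)
  last (yes p) (no _) = sym (ind-yes (x ℕ.<? suc m) (ℕP.m<n⇒m<1+n p))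
  last (no ¬p) (yes refl) = sym (ind-yes (x ℕ.<? suc m) ℕP.≤-refl)
  last (no ¬p) (no m≢x) = sym (ind-no (x ℕ.<? suc m) (λ q → ¬p (ℕP.≤∧≢⇒< (ℕP.≤-pred q) (λ e → m≢x (sym e)))))

count-upTo-< : ∀ m x → x < m → Countℕ.count (upTo m) x ≡ 1
count-upTo-< m x p = trans (count-upTo m x) (ind-yes (x ℕ.<? m) p)

count-intRange : ∀ n x → 1 ≤ ℤ.∣ x ∣ → ℤ.∣ x ∣ ≤ n → Countℤ.count (intRange n) x ≡ 1
count-intRange n (+ k) p q = begin
    Countℤ.count (intRange n) (+ k)
  ≡⟨ Σ-++ (map (λ z → + z) (upTo (suc n))) (map -[1+_] (upTo n)) f ⟩
    Countℤ.count (map (λ z → + z) (upTo (suc n))) (+ k) + Countℤ.count (map -[1+_] (upTo n)) (+ k)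
  ≡⟨ cong₂ _+_ (trans (Σ-map (λ z → + z) (upTo (suc n)) f) (Σ-ext (upTo (suc n)) (λ j → ind-⇔ (+ j ℤ.≟ + k) (j ℕ.≟ k) ℤP.+-injective (cong (λ z → + z)))))
               (trans (Σ-map -[1+_] (upTo n) f) (Σ-zero (upTo n) (λ j _ → ind-no (-[1+ j ] ℤ.≟ + k) (λ ())))) ⟩
    Countℕ.count (upTo (suc n)) k + 0
  ≡⟨ trans (+-identityʳ _) (count-upTo-< (suc n) k (s≤s q)) ⟩
    1 ∎
  where
  open ≡-Reasoning
  f : ℤ → ℕ
  f y = ind (y ℤ.≟ + k)
count-intRange (suc n) -[1+ k ] p q = begin
    Countℤ.count (intRange (suc n)) -[1+ k ]
  ≡⟨ Σ-++ (map (λ z → + z) (upTo (suc (suc n)))) (map -[1+_] (upTo (suc n))) f ⟩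
    Countℤ.count (map (λ z → + z) (upTo (suc (suc n)))) -[1+ k ] + Countℤ.count (map -[1+_] (upTo (suc n))) -[1+ k ]
  ≡⟨ cong₂ _+_ (trans (Σ-map (λ z → + z) (upTo (suc (suc n))) f) (Σ-zero (upTo (suc (suc n))) (λ j _ → ind-no (+ j ℤ.≟ -[1+ k ]) (λ ()))))
               (trans (Σ-map -[1+_] (upTo (suc n)) f) (Σ-ext (upTo (suc n)) (λ j → ind-⇔ (-[1+ j ] ℤ.≟ -[1+ k ]) (j ℕ.≟ k) ℤP.-[1+-injective (cong -[1+_])))) ⟩
    0 + Countℕ.count (upTo (suc n)) k
  ≡⟨ count-upTo-< (suc n) k q ⟩
    1 ∎
  where
  open ≡-Reasoning
  f : ℤ → ℕ
  f y = ind (y ℤ.≟ -[1+ k ])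


-- A pseudo-composition α of n is encoded by its descent word: the word of length n whose
-- i-th letter is true iff i ∈ D(α).  'runs' reads the composition back off the word.

tailWord : List ℕ → List Bool
tailWord []       = []
tailWord (b ∷ bs) = true ∷ (replicate (b ∸ 1) false ++ tailWord bs)

descentWord : List ℕ → List Bool
descentWord []       = []
descentWord (a ∷ bs) = replicate a false ++ tailWord bs

runs : ℕ → List Bool → List ℕ
runs c []           = c ∷ []
runs c (true ∷ bs)  = c ∷ runs 1 bs
runs c (false ∷ bs) = runs (suc c) bs

fromDescentWord : List Bool → List ℕ
fromDescentWord = runs 0

countTrue : List Bool → ℕ
countTrue []           = 0
countTrue (true ∷ bs)  = suc (countTrue bs)
countTrue (false ∷ bs) = countTrue bs

runs-replicate : ∀ k c X → runs c (replicate k false ++ X) ≡ runs (k + c) X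
runs-replicate zero c X = refl
runs-replicate (suc k) c X = trans (runs-replicate k (suc c) X) (cong (λ z → runs z X) (ℕP.+-suc k c))

runs-tailWord : ∀ c rest → All (1 ≤_) rest → runs c (tailWord rest) ≡ c ∷ rest
runs-tailWord c [] [] = refl
runs-tailWord c (suc b ∷ r) (_ ∷ ps) = cong (c ∷_) (trans (runs-replicate b 1 (tailWord r))
                                              (trans (cong (λ z → runs z (tailWord r)) (+-comm b 1)) (runs-tailWord (suc b) r ps)))

fromDescentWord-descentWord : ∀ a rest → All (1 ≤_) rest → fromDescentWord (descentWord (a ∷ rest)) ≡ a ∷ rest
fromDescentWord-descentWord a rest ps = trans (runs-replicate a 0 (tailWord rest)) (trans (cong (λ z → runs z (tailWord rest)) (+-identityʳ a)) (runs-tailWord a rest ps))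

replicate-suc-++ : ∀ c (X : List Bool) → replicate (suc c) false ++ X ≡ replicate c false ++ (false ∷ X)
replicate-suc-++ zero X = refl
replicate-suc-++ (suc c) X = cong (false ∷_) (replicate-suc-++ c X)

tailWord-runs : ∀ c bs → tailWord (runs (suc c) bs) ≡ true ∷ (replicate c false ++ bs)
tailWord-runs c [] = refl
tailWord-runs c (true ∷ bs) = cong (λ z → true ∷ (replicate c false ++ z)) (tailWord-runs 0 bs)
tailWord-runs c (false ∷ bs) = trans (tailWord-runs (suc c) bs) (cong (true ∷_) (replicate-suc-++ c bs))

descentWord-runs : ∀ c bs → descentWord (runs c bs) ≡ replicate c false ++ bs
descentWord-runs c [] = refl
descentWord-runs c (true ∷ bs) = cong (replicate c false ++_) (tailWord-runs 0 bs)
descentWord-runs c (false ∷ bs) = trans (descentWord-runs (suc c) bs) (replicate-suc-++ c bs)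

descentWord-fromDescentWord : ∀ bs → descentWord (fromDescentWord bs) ≡ bs
descentWord-fromDescentWord bs = descentWord-runs 0 bs

length-runs : ∀ c bs → length (runs c bs) ≡ suc (countTrue bs)
length-runs c [] = refl
length-runs c (true ∷ bs) = cong suc (length-runs 1 bs)
length-runs c (false ∷ bs) = length-runs (suc c) bs

sum-runs : ∀ c bs → sum (runs c bs) ≡ c + length bs
sum-runs c [] = trans (+-identityʳ c) (sym (+-identityʳ c))
sum-runs c (true ∷ bs) = cong (_+_ c) (sum-runs 1 bs)
sum-runs c (false ∷ bs) = trans (sum-runs (suc c) bs) (sym (ℕP.+-suc c (length bs)))

runs-positive : ∀ c bs → All (λ a → 0 < a) (runs (suc c) bs)
runs-positive c [] = s≤s z≤n ∷ []
runs-positive c (true ∷ bs) = s≤s z≤n ∷ runs-positive 0 bs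
runs-positive c (false ∷ bs) = runs-positive (suc c) bs

drop1-runs-positive : ∀ c bs → All (λ a → 0 < a) (drop 1 (runs c bs))
drop1-runs-positive c [] = []
drop1-runs-positive c (true ∷ bs) = runs-positive 0 bs
drop1-runs-positive c (false ∷ bs) = drop1-runs-positive (suc c) bs

fromDescentWord-isPseudoComposition : ∀ n bs → length bs ≡ n → IsPseudoComposition n (fromDescentWord bs)
fromDescentWord-isPseudoComposition n bs e = subst (1 ≤_) (sym (length-runs 0 bs)) (s≤s z≤n) , drop1-runs-positive 0 bs , trans (sum-runs 0 bs) e

bitAt : List Bool → ℕ → Bool
bitAt []       _       = false
bitAt (b ∷ bs) zero    = b
bitAt (b ∷ bs) (suc i) = bitAt bs i

replicate-+-split : ∀ s b' (T : List Bool) → replicate (s + suc b') false ++ T ≡ replicate s false ++ (false ∷ (replicate b' false ++ T))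
replicate-+-split zero b' T = refl
replicate-+-split (suc s) b' T = cong (false ∷_) (replicate-+-split s b' T)

bitAt-set : ∀ s i (Y : List Bool) → i ≡ s → bitAt (replicate s false ++ (true ∷ Y)) i ≡ true
bitAt-set zero .zero Y refl = refl
bitAt-set (suc s) .(suc s) Y refl = bitAt-set s s Y refl

bitAt-set-mono : ∀ s i (Y : List Bool) → bitAt (replicate s false ++ (false ∷ Y)) i ≡ true → bitAt (replicate s false ++ (true ∷ Y)) i ≡ true
bitAt-set-mono zero zero Y ()
bitAt-set-mono zero (suc i) Y p = p
bitAt-set-mono (suc s) zero Y ()
bitAt-set-mono (suc s) (suc i) Y p = bitAt-set-mono s i Y p

bitAt-set-inv : ∀ s i (Y : List Bool) → bitAt (replicate s false ++ (true ∷ Y)) i ≡ true → i ≡ s ⊎ bitAt (replicate s false ++ (false ∷ Y)) i ≡ true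
bitAt-set-inv zero zero Y p = inj₁ refl
bitAt-set-inv zero (suc i) Y p = inj₂ p
bitAt-set-inv (suc s) zero Y ()
bitAt-set-inv (suc s) (suc i) Y p with bitAt-set-inv s i Y p
... | inj₁ e = inj₁ (cong suc e)
... | inj₂ q = inj₂ q

bitAt-replicate-false : ∀ s i → bitAt (replicate s false ++ []) i ≡ true → ⊥
bitAt-replicate-false zero zero ()
bitAt-replicate-false zero (suc i) ()
bitAt-replicate-false (suc s) zero ()
bitAt-replicate-false (suc s) (suc i) p = bitAt-replicate-false s i p

partialSums⇔bitAt : ∀ rest → All (1 ≤_) rest → ∀ s i →
  (i ∈ partialSums s rest → bitAt (replicate s false ++ tailWord rest) i ≡ true) ×
  (bitAt (replicate s false ++ tailWord rest) i ≡ true → i ∈ partialSums s rest)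
partialSums⇔bitAt [] [] s i = (λ ()) , (λ p → ⊥-elim (bitAt-replicate-false s i p))
partialSums⇔bitAt (suc b' ∷ r) (_ ∷ ps) s i = to , from
  where
  IH = partialSums⇔bitAt r ps (s + suc b') i
  eq : replicate (s + suc b') false ++ tailWord r ≡ replicate s false ++ (false ∷ (replicate b' false ++ tailWord r))
  eq = replicate-+-split s b' (tailWord r)
  to : i ∈ partialSums s (suc b' ∷ r) → bitAt (replicate s false ++ tailWord (suc b' ∷ r)) i ≡ true
  to (here e) = bitAt-set s i _ e
  to (there m) = bitAt-set-mono s i _ (subst (λ L → bitAt L i ≡ true) eq (proj₁ IH m))
  from : bitAt (replicate s false ++ tailWord (suc b' ∷ r)) i ≡ true → i ∈ partialSums s (suc b' ∷ r)
  from p with bitAt-set-inv s i _ p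
  ... | inj₁ e = here e
  ... | inj₂ q = there (proj₂ IH (subst (λ L → bitAt L i ≡ true) (sym eq) q))

DesSet⇔bitAt : ∀ a rest n → IsPseudoComposition n (a ∷ rest) → ∀ i →
  (i ∈ DesSet (a ∷ rest) → bitAt (descentWord (a ∷ rest)) i ≡ true) × (bitAt (descentWord (a ∷ rest)) i ≡ true → i ∈ DesSet (a ∷ rest))
DesSet⇔bitAt a rest n pc i = partialSums⇔bitAt rest (proj₁ (proj₂ pc)) a i

length-replicate-++ : ∀ a (X : List Bool) → length (replicate a false ++ X) ≡ a + length X
length-replicate-++ a X = trans (LP.length-++ (replicate a false)) (cong (_+ length X) (LP.length-replicate a))

length-tailWord : ∀ rest → All (1 ≤_) rest → length (tailWord rest) ≡ sum rest
length-tailWord [] [] = refl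
length-tailWord (suc b' ∷ r) (_ ∷ ps) = cong suc (trans (length-replicate-++ b' (tailWord r)) (cong (_+_ b') (length-tailWord r ps)))

length-descentWord : ∀ a rest n → IsPseudoComposition n (a ∷ rest) → length (descentWord (a ∷ rest)) ≡ n
length-descentWord a rest n (l , ps , s) = trans (length-replicate-++ a (tailWord rest)) (trans (cong (_+_ a) (length-tailWord rest ps)) s)

countTrue≤length : ∀ bs → countTrue bs ≤ length bs
countTrue≤length [] = z≤n
countTrue≤length (true ∷ bs) = s≤s (countTrue≤length bs)
countTrue≤length (false ∷ bs) = ℕP.m≤n⇒m≤1+n (countTrue≤length bs)

All-≤-sum : ∀ xs → All (_≤ sum xs) xs
All-≤-sum [] = []
All-≤-sum (x ∷ xs) = ℕP.m≤m+n x (sum xs) ∷ All.map (λ p → ℕP.≤-trans p (ℕP.m≤n+m (sum xs) x)) (All-≤-sum xs)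

bitAt-≥length : ∀ x i → length x ≤ i → bitAt x i ≡ false
bitAt-≥length [] i _ = refl
bitAt-≥length (b ∷ x) (suc i) (s≤s p) = bitAt-≥length x i p

bitAt-applyUpTo : ∀ (f : ℕ → Bool) n i → i < n → bitAt (applyUpTo f n) i ≡ f i
bitAt-applyUpTo f (suc n) zero _ = refl
bitAt-applyUpTo f (suc n) (suc i) (s≤s p) = bitAt-applyUpTo (λ z → f (suc z)) n i p

bitAt-extensionality : ∀ x y → length x ≡ length y → (∀ i → bitAt x i ≡ bitAt y i) → x ≡ y
bitAt-extensionality [] [] _ _ = refl
bitAt-extensionality (a ∷ x) (b ∷ y) e h = cong₂ _∷_ (h zero) (bitAt-extensionality x y (ℕP.suc-injective e) (λ i → h (suc i)))


-- Möbius inversion on descent words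

bools : List Bool
bools = true ∷ false ∷ []

module CountBool = Multiplicity B._≟_
open Countℕ using () renaming (_≟*_ to _≟ℕ*_)
open CountBool using () renaming (_≟*_ to _≟𝔹*_)

count-bools : ∀ b → CountBool.count bools b ≡ 1
count-bools true = refl
count-bools false = refl

All-count-bools : ∀ (bs : List Bool) → All (λ b → CountBool.count bools b ≡ 1) bs
All-count-bools [] = []
All-count-bools (b ∷ bs) = count-bools b ∷ All-count-bools bs

count-candidates : ∀ n bs → length bs ≡ n → Σ (candidates n) (λ β → ind (β ≟ℕ* fromDescentWord bs)) ≡ 1
count-candidates n bs e = begin
    Σ (candidates n) (λ β → ind (β ≟ℕ* v))
  ≡⟨ Σ-concatMap (allLists (upTo (suc n))) (upTo (n + 2)) _ ⟩
    Σ (upTo (n + 2)) (λ k → Σ (allLists (upTo (suc n)) k) (λ β → ind (β ≟ℕ* v)))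
  ≡⟨ Σ-ext (upTo (n + 2)) (λ k → Countℕ.Σ-allLists-δ (upTo (suc n)) k v entries) ⟩
    Σ (upTo (n + 2)) (λ k → ind (length v ℕ.≟ k))
  ≡⟨ Σ-ext (upTo (n + 2)) (λ k → ind-⇔ (length v ℕ.≟ k) (k ℕ.≟ length v) sym sym) ⟩
    Countℕ.count (upTo (n + 2)) (length v)
  ≡⟨ count-upTo-< (n + 2) (length v) lt ⟩
    1 ∎
  where
  open ≡-Reasoning
  v = fromDescentWord bs
  sv : sum v ≡ n
  sv = trans (sum-runs 0 bs) e
  entries : All (λ x → Countℕ.count (upTo (suc n)) x ≡ 1) v
  entries = All.map (λ {x} p → count-upTo-< (suc n) x (s≤s (subst (x ≤_) sv p))) (All-≤-sum v)
  lt : length v < n + 2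
  lt = subst (_< n + 2) (sym (length-runs 0 bs))
         (subst (suc (suc (countTrue bs)) ≤_) (+-comm 2 n) (s≤s (s≤s (subst (countTrue bs ≤_) e (countTrue≤length bs)))))

count-descentWords : ∀ n β → IsPseudoComposition n β →
  Σ (allLists bools n) (λ bs → ind (fromDescentWord bs ≟ℕ* β)) ≡ 1
count-descentWords n [] (() , _)
count-descentWords n (a ∷ rest) pc = begin
    Σ (allLists bools n) (λ bs → ind (fromDescentWord bs ≟ℕ* (a ∷ rest)))
  ≡⟨ Σ-ext (allLists bools n) (λ bs → ind-⇔ (fromDescentWord bs ≟ℕ* (a ∷ rest)) (bs ≟𝔹* descentWord (a ∷ rest))
        (λ eq → trans (sym (descentWord-fromDescentWord bs)) (cong descentWord eq))
        (λ eq → trans (cong fromDescentWord eq) (fromDescentWord-descentWord a rest (proj₁ (proj₂ pc))))) ⟩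
    Σ (allLists bools n) (λ bs → ind (bs ≟𝔹* descentWord (a ∷ rest)))
  ≡⟨ CountBool.Σ-allLists-δ bools n (descentWord (a ∷ rest)) (All-count-bools _) ⟩
    ind (length (descentWord (a ∷ rest)) ℕ.≟ n)
  ≡⟨ ind-yes (length (descentWord (a ∷ rest)) ℕ.≟ n) (length-descentWord a rest n pc) ⟩
    1 ∎
  where open ≡-Reasoning

Σ-pseudoCompositions : ∀ n (G : List ℕ → ℤ) →
  Σℤ (candidates n) (λ β → ifℤ (isPseudoComposition? n β) (G β)) ≡ Σℤ (allLists bools n) (λ bs → G (fromDescentWord bs))
Σ-pseudoCompositions n G = begin
    Σℤ (candidates n) (λ β → ifℤ (isPseudoComposition? n β) (G β))
  ≡⟨ Σℤ-ext (candidates n) (λ β → expand β (isPseudoComposition? n β)) ⟩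
    Σℤ (candidates n) (λ β → Σℤ words (λ bs → matched bs β))
  ≡⟨ Σℤ-swap (candidates n) words (λ β bs → matched bs β) ⟩
    Σℤ words (λ bs → Σℤ (candidates n) (matched bs))
  ≡⟨ Σℤ-allLists-cong bools n collapse ⟩
    Σℤ words (λ bs → G (fromDescentWord bs)) ∎
  where
  open ≡-Reasoning
  words = allLists bools n
  matched : List Bool → List ℕ → ℤ
  matched bs β = ifℤ (fromDescentWord bs ≟ℕ* β) (ifℤ (isPseudoComposition? n β) (G β))
  ifℤ-zero : {P : Set} (p : Dec P) → ifℤ p (+ 0) ≡ + 0
  ifℤ-zero (yes _) = refl
  ifℤ-zero (no _)  = refl
  expand : ∀ β (d : Dec (IsPseudoComposition n β)) → ifℤ d (G β) ≡ Σℤ words (λ bs → ifℤ (fromDescentWord bs ≟ℕ* β) (ifℤ d (G β)))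
  expand β (no _) = sym (trans (Σℤ-ext words (λ bs → ifℤ-zero (fromDescentWord bs ≟ℕ* β))) (Σℤ-zero words))
  expand β (yes pc) = sym (begin
      Σℤ words (λ bs → ifℤ (fromDescentWord bs ≟ℕ* β) (G β))
    ≡⟨ Σℤ-ifℤ-const (λ bs → fromDescentWord bs ≟ℕ* β) words (G β) ⟩
      + Σ words (λ bs → ind (fromDescentWord bs ≟ℕ* β)) ℤ.* G β
    ≡⟨ cong (λ z → + z ℤ.* G β) (count-descentWords n β pc) ⟩
      + 1 ℤ.* G β
    ≡⟨ ℤP.*-identityˡ (G β) ⟩
      G β ∎)
  collapse : ∀ bs → length bs ≡ n → Σℤ (candidates n) (matched bs) ≡ G (fromDescentWord bs)
  collapse bs e = begin
      Σℤ (candidates n) (matched bs)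
    ≡⟨ Σℤ-ext (candidates n) (λ β → flipped β (fromDescentWord bs ≟ℕ* β) (β ≟ℕ* fromDescentWord bs)) ⟩
      Σℤ (candidates n) (λ β → ifℤ (β ≟ℕ* fromDescentWord bs) (G (fromDescentWord bs)))
    ≡⟨ Σℤ-ifℤ-const (λ β → β ≟ℕ* fromDescentWord bs) (candidates n) (G (fromDescentWord bs)) ⟩
      + Σ (candidates n) (λ β → ind (β ≟ℕ* fromDescentWord bs)) ℤ.* G (fromDescentWord bs)
    ≡⟨ cong (λ z → + z ℤ.* G (fromDescentWord bs)) (count-candidates n bs e) ⟩
      + 1 ℤ.* G (fromDescentWord bs)
    ≡⟨ ℤP.*-identityˡ _ ⟩
      G (fromDescentWord bs) ∎
    where
    flipped : ∀ β (p : Dec (fromDescentWord bs ≡ β)) (q : Dec (β ≡ fromDescentWord bs)) →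
              ifℤ p (ifℤ (isPseudoComposition? n β) (G β)) ≡ ifℤ q (G (fromDescentWord bs))
    flipped β (yes refl) q = trans (ifℤ-yes (isPseudoComposition? n β) (G β) (fromDescentWord-isPseudoComposition n bs e))
                                   (sym (ifℤ-yes q _ refl))
    flipped β (no ¬p) q = sym (ifℤ-no q _ (λ eq → ¬p (sym eq)))

subsetᵇ : List Bool → List Bool → Bool
subsetᵇ [] [] = true
subsetᵇ (x ∷ xs) (y ∷ ys) = (B.not x B.∨ y) B.∧ subsetᵇ xs ys
subsetᵇ _ _ = false

subsetᵇ⇒countTrue≤ : ∀ bs a → subsetᵇ bs a ≡ true → countTrue bs ≤ countTrue a
subsetᵇ⇒countTrue≤ [] [] _ = z≤n
subsetᵇ⇒countTrue≤ (true ∷ bs) (true ∷ a) p = s≤s (subsetᵇ⇒countTrue≤ bs a p)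
subsetᵇ⇒countTrue≤ (false ∷ bs) (true ∷ a) p = ℕP.m≤n⇒m≤1+n (subsetᵇ⇒countTrue≤ bs a p)
subsetᵇ⇒countTrue≤ (false ∷ bs) (false ∷ a) p = subsetᵇ⇒countTrue≤ bs a p
subsetᵇ⇒countTrue≤ (true ∷ bs) (false ∷ a) ()
subsetᵇ⇒countTrue≤ [] (_ ∷ _) ()
subsetᵇ⇒countTrue≤ (_ ∷ _) [] ()

-- Summed over S, this is the Möbius function of the Boolean lattice: Σ_{c ⊆ S ⊆ a} (-1)^{|a|-|S|} = [c = a].
möbiusTerm : List Bool → List Bool → List Bool → ℤ
möbiusTerm c a bs = if subsetᵇ c bs B.∧ subsetᵇ bs a then ℤ.-1ℤ ℤ.^ (countTrue a ∸ countTrue bs) else + 0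

möbiusTerm-suc : ∀ c a bs → (if subsetᵇ c bs B.∧ subsetᵇ bs a then ℤ.-1ℤ ℤ.^ (suc (countTrue a) ∸ countTrue bs) else + 0) ≡ ℤ.-1ℤ ℤ.* möbiusTerm c a bs
möbiusTerm-suc c a bs with subsetᵇ c bs | subsetᵇ bs a in eq
... | true | true = cong (ℤ.-1ℤ ℤ.^_) (ℕP.+-∸-assoc 1 (subsetᵇ⇒countTrue≤ bs a eq))
... | true | false = refl
... | false | _ = refl

Σ-möbiusTerm : ∀ n c a → length c ≡ n → length a ≡ n →
  Σℤ (allLists bools n) (möbiusTerm c a) ≡ (if does (c ≟𝔹* a) then + 1 else + 0)
Σ-möbiusTerm zero [] [] _ _ = refl
Σ-möbiusTerm (suc n) (c0 ∷ c) (a0 ∷ a) ec ea = trans (Σℤ-allLists-suc bools n (möbiusTerm (c0 ∷ c) (a0 ∷ a))) (by-heads c0 a0)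
  where
  ec' = ℕP.suc-injective ec
  ea' = ℕP.suc-injective ea
  L = allLists bools n
  IH = Σ-möbiusTerm n c a ec' ea'
  Σℤ-vanishes : ∀ (f : List Bool → ℤ) → (∀ bs → f bs ≡ + 0) → Σℤ L f ≡ + 0
  Σℤ-vanishes f p = trans (Σℤ-ext L p) (Σℤ-zero L)
  by-heads : ∀ c0 a0 → Σℤ bools (λ b → Σℤ L (λ bs → möbiusTerm (c0 ∷ c) (a0 ∷ a) (b ∷ bs))) ≡ (if does ((c0 ∷ c) ≟𝔹* (a0 ∷ a)) then + 1 else + 0)
  ifF : ∀ x (y : ℤ) → (if x B.∧ false then y else + 0) ≡ + 0
  ifF true y = refl
  ifF false y = refl
  by-heads false false = begin
      Σℤ L (λ bs → möbiusTerm (false ∷ c) (false ∷ a) (true ∷ bs)) ℤ.+ (Σℤ L (möbiusTerm c a) ℤ.+ + 0)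
    ≡⟨ cong₂ ℤ._+_ (Σℤ-vanishes _ (λ bs → ifF (subsetᵇ c bs) _)) (trans (ℤP.+-identityʳ _) IH) ⟩
      + 0 ℤ.+ (if does (c ≟𝔹* a) then + 1 else + 0)
    ≡⟨ ℤP.+-identityˡ _ ⟩
      (if does (c ≟𝔹* a) then + 1 else + 0) ∎
    where open ≡-Reasoning
  by-heads true true = begin
      Σℤ L (möbiusTerm c a) ℤ.+ (Σℤ L (λ bs → möbiusTerm (true ∷ c) (true ∷ a) (false ∷ bs)) ℤ.+ + 0)
    ≡⟨ cong₂ ℤ._+_ IH (trans (ℤP.+-identityʳ _) (Σℤ-vanishes _ (λ bs → refl))) ⟩
      (if does (c ≟𝔹* a) then + 1 else + 0) ℤ.+ + 0
    ≡⟨ ℤP.+-identityʳ _ ⟩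
      (if does (c ≟𝔹* a) then + 1 else + 0) ∎
    where open ≡-Reasoning
  by-heads true false = trans (cong₂ ℤ._+_ (Σℤ-vanishes _ (λ bs → ifF (subsetᵇ c bs) _)) (trans (ℤP.+-identityʳ _) (Σℤ-vanishes _ (λ bs → refl)))) refl
  by-heads false true = begin
      Σℤ L (möbiusTerm c a) ℤ.+ (Σℤ L (λ bs → möbiusTerm (false ∷ c) (true ∷ a) (false ∷ bs)) ℤ.+ + 0)
    ≡⟨ cong (ℤ._+_ (Σℤ L (möbiusTerm c a))) (trans (ℤP.+-identityʳ _) (trans (Σℤ-ext L (λ bs → möbiusTerm-suc c a bs)) (Σℤ-*ˡ L ℤ.-1ℤ (möbiusTerm c a)))) ⟩
      Σℤ L (möbiusTerm c a) ℤ.+ ℤ.-1ℤ ℤ.* Σℤ L (möbiusTerm c a)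
    ≡⟨ cong (ℤ._+_ (Σℤ L (möbiusTerm c a))) (ℤP.-1*i≡-i _) ⟩
      Σℤ L (möbiusTerm c a) ℤ.+ ℤ.- Σℤ L (möbiusTerm c a)
    ≡⟨ ℤP.+-inverseʳ (Σℤ L (möbiusTerm c a)) ⟩
      + 0 ∎
    where open ≡-Reasoning

subsetᵇ-complete : ∀ x y → length x ≡ length y → (∀ i → bitAt x i ≡ true → bitAt y i ≡ true) → subsetᵇ x y ≡ true
subsetᵇ-complete [] [] _ _ = refl
subsetᵇ-complete (false ∷ x) (b ∷ y) e h = subsetᵇ-complete x y (ℕP.suc-injective e) (λ i → h (suc i))
subsetᵇ-complete (true ∷ x) (b ∷ y) e h rewrite h zero refl = subsetᵇ-complete x y (ℕP.suc-injective e) (λ i → h (suc i))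

subsetᵇ-sound : ∀ x y → subsetᵇ x y ≡ true → ∀ i → bitAt x i ≡ true → bitAt y i ≡ true
subsetᵇ-sound [] [] _ i ()
subsetᵇ-sound (true ∷ x) (true ∷ y) p zero q = refl
subsetᵇ-sound (true ∷ x) (false ∷ y) () zero q
subsetᵇ-sound (false ∷ x) (b ∷ y) p zero ()
subsetᵇ-sound (true ∷ x) (true ∷ y) p (suc i) q = subsetᵇ-sound x y p i q
subsetᵇ-sound (true ∷ x) (false ∷ y) () (suc i) q
subsetᵇ-sound (false ∷ x) (b ∷ y) p (suc i) q = subsetᵇ-sound x y p i q
subsetᵇ-sound [] (_ ∷ _) () i q
subsetᵇ-sound (_ ∷ _) [] () i q


descentBits : ℕ → List ℤ → List Bool
descentBits n w = applyUpTo (λ i → does (isDescent? w i)) n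

isEvenSignedPerm? : ∀ n w → Dec (IsSignedPerm n w × IsEven w)
isEvenSignedPerm? n w = isSignedPerm? n w ×-dec isEven? w

boolToℕ : Bool → ℕ
boolToℕ true = 1
boolToℕ false = 0


-- Signed permutations and the insertion of the largest entry

insertAt : ℕ → ℤ → List ℤ → List ℤ
insertAt zero    v u       = v ∷ u
insertAt (suc q) v []      = v ∷ []
insertAt (suc q) v (x ∷ u) = x ∷ insertAt q v u

removeAt : ℕ → List ℤ → List ℤ
removeAt _       []      = []
removeAt zero    (x ∷ u) = u
removeAt (suc q) (x ∷ u) = x ∷ removeAt q u

length-insertAt : ∀ q v u → length (insertAt q v u) ≡ suc (length u)
length-insertAt zero v u = refl
length-insertAt (suc q) v [] = refl
length-insertAt (suc q) v (x ∷ u) = cong suc (length-insertAt q v u)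

length-removeAt : ∀ q u → q < length u → suc (length (removeAt q u)) ≡ length u
length-removeAt zero (x ∷ u) _ = refl
length-removeAt (suc q) (x ∷ u) (s≤s p) = cong suc (length-removeAt q u p)

entry-insertAt : ∀ q v u → q ≤ length u → entry (insertAt q v u) q ≡ v
entry-insertAt zero v u _ = refl
entry-insertAt (suc q) v (x ∷ u) (s≤s p) = entry-insertAt q v u p

removeAt-insertAt : ∀ q v u → q ≤ length u → removeAt q (insertAt q v u) ≡ u
removeAt-insertAt zero v u _ = refl
removeAt-insertAt (suc q) v (x ∷ u) (s≤s p) = cong (x ∷_) (removeAt-insertAt q v u p)

insertAt-removeAt : ∀ q w → q < length w → insertAt q (entry w q) (removeAt q w) ≡ w
insertAt-removeAt zero (x ∷ w) _ = refl
insertAt-removeAt (suc q) (x ∷ w) (s≤s p) = cong (x ∷_) (insertAt-removeAt q w p)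

All-entry : {P : ℤ → Set} → ∀ {w} → All P w → ∀ q → q < length w → P (entry w q)
All-entry (p ∷ ps) zero _ = p
All-entry (p ∷ ps) (suc q) (s≤s l) = All-entry ps q l

All-insertAt : {P : ℤ → Set} → ∀ q {v u} → P v → All P u → All P (insertAt q v u)
All-insertAt zero pv pu = pv ∷ pu
All-insertAt (suc q) pv [] = pv ∷ []
All-insertAt (suc q) pv (p ∷ pu) = p ∷ All-insertAt q pv pu

All-removeAt : {P : ℤ → Set} → ∀ q {u} → All P u → All P (removeAt q u)
All-removeAt q [] = []
All-removeAt zero (p ∷ pu) = pu
All-removeAt (suc q) (p ∷ pu) = p ∷ All-removeAt q pu

AbsDistinct : ℤ → ℤ → Set
AbsDistinct x y = ∣ x ∣ ≢ ∣ y ∣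

AllPairs-insertAt : ∀ q {v u} → All (λ x → AbsDistinct v x) u → AllPairs AbsDistinct u → AllPairs AbsDistinct (insertAt q v u)
AllPairs-insertAt zero av ap = av ∷ ap
AllPairs-insertAt (suc q) {u = []} av ap = [] ∷ []
AllPairs-insertAt (suc q) {u = x ∷ u} (dvx ∷ av) (ax ∷ ap) = All-insertAt q (λ e → dvx (sym e)) ax ∷ AllPairs-insertAt q av ap

AllPairs-removeAt : ∀ q {u} → AllPairs AbsDistinct u → AllPairs AbsDistinct (removeAt q u)
AllPairs-removeAt q [] = []
AllPairs-removeAt zero (a ∷ ap) = ap
AllPairs-removeAt (suc q) (a ∷ ap) = All-removeAt q a ∷ AllPairs-removeAt q ap

removeAt-AbsDistinct : ∀ q w → AllPairs AbsDistinct w → q < length w → All (λ x → AbsDistinct x (entry w q)) (removeAt q w)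
removeAt-AbsDistinct zero (y ∷ w) (a ∷ ap) _ = All.map (λ d e → d (sym e)) a
removeAt-AbsDistinct (suc q) (y ∷ w) (a ∷ ap) (s≤s l) = All-entry a q l ∷ removeAt-AbsDistinct q w ap l

absDistinct-position-unique : ∀ w → AllPairs AbsDistinct w → ∀ p q → p < length w → q < length w → ∣ entry w p ∣ ≡ ∣ entry w q ∣ → p ≡ q
absDistinct-position-unique (y ∷ w) ap zero zero _ _ _ = refl
absDistinct-position-unique (y ∷ w) (a ∷ ap) zero (suc q) _ (s≤s lq) e = ⊥-elim (All-entry a q lq e)
absDistinct-position-unique (y ∷ w) (a ∷ ap) (suc p) zero (s≤s lp) _ e = ⊥-elim (All-entry a p lp (sym e))
absDistinct-position-unique (y ∷ w) (a ∷ ap) (suc p) (suc q) (s≤s lp) (s≤s lq) e = cong suc (absDistinct-position-unique w ap p q lp lq e)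

insertAt-isSignedPerm : ∀ m q v u → IsSignedPerm m u → q ≤ length u → ∣ v ∣ ≡ suc m → IsSignedPerm (suc m) (insertAt q v u)
insertAt-isSignedPerm m q v u (len , bnd , ap) ql av =
  trans (length-insertAt q v u) (cong suc len) ,
  All-insertAt q (subst (1 ≤_) (sym av) (s≤s z≤n) , ℕP.≤-reflexive av) (All.map (λ (p , r) → p , ℕP.m≤n⇒m≤1+n r) bnd) ,
  AllPairs-insertAt q (All.map (λ {x} (_ , r) e → ℕP.<-irrefl refl (subst (_≤ m) (trans (sym e) av) r)) bnd) ap

removeAt-isSignedPerm : ∀ m q w → IsSignedPerm (suc m) w → q < length w → ∣ entry w q ∣ ≡ suc m → IsSignedPerm m (removeAt q w)
removeAt-isSignedPerm m q w (len , bnd , ap) ql av =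
  ℕP.suc-injective (trans (length-removeAt q w ql) len) ,
  All.zipWith (λ { ((p , r) , d) → p , ℕP.≤-pred (ℕP.≤∧≢⇒< r (λ e → d (trans e (sym av)))) }) (All-removeAt q bnd , removeAt-AbsDistinct q w ap ql) ,
  AllPairs-removeAt q ap

pred< : ∀ k → 1 ≤ k → k ∸ 1 < k
pred< (suc k) _ = ℕP.n<1+n k

absIndex : ℤ → ℕ
absIndex x = ∣ x ∣ ∸ 1

countAbsIndex : ℕ → List ℤ → ℕ
countAbsIndex j w = Σ w (λ x → ind (absIndex x ℕ.≟ j))

Σ-one : {A : Set} (xs : List A) → Σ xs (λ _ → 1) ≡ length xs
Σ-one [] = refl
Σ-one (x ∷ xs) = cong suc (Σ-one xs)

Σ-countAbsIndex : ∀ m w → All (λ x → absIndex x < m) w → Σ (upTo m) (λ j → countAbsIndex j w) ≡ length w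
Σ-countAbsIndex m w al = begin
    Σ (upTo m) (λ j → Σ w (λ x → ind (absIndex x ℕ.≟ j)))
  ≡⟨ sym (Σ-swap w (upTo m) (λ x j → ind (absIndex x ℕ.≟ j))) ⟩
    Σ w (λ x → Σ (upTo m) (λ j → ind (absIndex x ℕ.≟ j)))
  ≡⟨ Σ-congᴬ w al (λ x kx → trans (Σ-ext (upTo m) (λ j → ind-⇔ (absIndex x ℕ.≟ j) (j ℕ.≟ absIndex x) sym sym)) (count-upTo-< m (absIndex x) kx)) ⟩
    Σ w (λ _ → 1)
  ≡⟨ Σ-one w ⟩
    length w ∎
  where open ≡-Reasoning

countAbsIndex≤1 : ∀ w → AllPairs (λ x y → absIndex x ≢ absIndex y) w → ∀ j → countAbsIndex j w ≤ 1
countAbsIndex≤1 [] _ j = z≤n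
countAbsIndex≤1 (x ∷ w) (a ∷ ap) j with absIndex x ℕ.≟ j
... | no _ = countAbsIndex≤1 w ap j
... | yes refl = s≤s (ℕP.≤-reflexive (Σ-zero w (λ y m → ind-no (absIndex y ℕ.≟ absIndex x) (λ e → All.lookup a m (sym e)))))

Σ≡length⇒All≡1 : {A : Set} (L : List A) (f : A → ℕ) → Σ L f ≡ length L → (∀ j → f j ≤ 1) → All (λ j → f j ≡ 1) L
Σ≡length⇒All≡1 [] f _ _ = []
Σ≡length⇒All≡1 (j ∷ L) f e b = by-value (f j) refl (b j)
  where
  ΣL≤ : ∀ L' → Σ L' f ≤ length L'
  ΣL≤ [] = z≤n
  ΣL≤ (k ∷ L') = ℕP.+-mono-≤ (b k) (ΣL≤ L')
  by-value : ∀ c → f j ≡ c → c ≤ 1 → All (λ j → f j ≡ 1) (j ∷ L)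
  by-value zero eq _ = ⊥-elim (ℕP.<-irrefl refl (ℕP.≤-trans (ℕP.≤-reflexive (sym (trans (cong (_+ Σ L f) (sym eq)) e))) (ΣL≤ L)))
  by-value (suc zero) eq _ = eq ∷ Σ≡length⇒All≡1 L f (ℕP.suc-injective (trans (cong (_+ Σ L f) (sym eq)) e)) b
  by-value (suc (suc c)) eq (s≤s ())

signedPerm-absIndex : ∀ n w → IsSignedPerm n w → All (λ x → absIndex x < n) w × AllPairs (λ x y → absIndex x ≢ absIndex y) w
signedPerm-absIndex n w (len , bnd , ap) = All.map (λ {x} → kb {x}) bnd , apk w bnd ap
  where
  kb : ∀ {x} → 1 ≤ ∣ x ∣ × ∣ x ∣ ≤ n → absIndex x < n
  kb {x} (p , q) = ℕP.<-≤-trans (pred< ∣ x ∣ p) q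
  kinj : ∀ {x y} → 1 ≤ ∣ x ∣ → 1 ≤ ∣ y ∣ → absIndex x ≡ absIndex y → ∣ x ∣ ≡ ∣ y ∣
  kinj {x} {y} px py e = trans (sym (ℕP.m∸n+n≡m px)) (trans (cong (_+ 1) e) (ℕP.m∸n+n≡m py))
  apk : ∀ w → All (λ x → 1 ≤ ∣ x ∣ × ∣ x ∣ ≤ n) w → AllPairs AbsDistinct w → AllPairs (λ x y → absIndex x ≢ absIndex y) w
  apk [] _ _ = []
  apk (x ∷ w) ((px , _) ∷ bs) (a ∷ ap) =
    All.zipWith (λ { {y} (d , (py , _)) e → d (kinj {x} {y} px py e) }) (a , bs) ∷ apk w bs ap

countAbsIndex-signedPerm : ∀ n w → IsSignedPerm n w → ∀ j → j < n → countAbsIndex j w ≡ 1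
countAbsIndex-signedPerm n w sp j jl = All.lookup (Σ≡length⇒All≡1 (upTo n) (λ j → countAbsIndex j w) (trans (Σ-countAbsIndex n w (proj₁ ks)) (trans (proj₁ sp) (sym (LP.length-upTo n)))) (countAbsIndex≤1 w (proj₂ ks)))
                        (∈-upTo⁺ jl)
  where
  ks = signedPerm-absIndex n w sp

Σ-positive⇒entry : ∀ {P : ℤ → Set} (P? : ∀ x → Dec (P x)) w → 1 ≤ Σ w (λ x → ind (P? x)) → ∃ λ q → q < length w × P (entry w q)
Σ-positive⇒entry P? [] ()
Σ-positive⇒entry P? (x ∷ w) p with P? x
... | yes px = zero , s≤s z≤n , px
... | no _ with Σ-positive⇒entry P? w p
... | q , l , pq = suc q , s≤s l , pq

signedPerm-surjective : ∀ n w → IsSignedPerm n w → ∀ k → 1 ≤ k → k ≤ n → ∃ λ q → q < length w × ∣ entry w q ∣ ≡ k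
signedPerm-surjective n w sp k k1 kn with Σ-positive⇒entry (λ x → absIndex x ℕ.≟ (k ∸ 1)) w
                            (ℕP.≤-reflexive (sym (countAbsIndex-signedPerm n w sp (k ∸ 1) (ℕP.<-≤-trans (pred< k k1) kn))))
... | q , l , e = q , l , trans (sym (ℕP.m∸n+n≡m (proj₁ (All-entry (proj₁ (proj₂ sp)) q l)))) (trans (cong (_+ 1) e) (ℕP.m∸n+n≡m k1))

open Countℤ using () renaming (_≟*_ to _≟ℤ*_)

± : ℕ → List ℤ
± m = + suc m ∷ -[1+ m ] ∷ []

±-abs : ∀ m v → v ∈ ± m → ∣ v ∣ ≡ suc m
±-abs m v (here refl) = refl
±-abs m v (there (here refl)) = refl

count-± : ∀ m x → ∣ x ∣ ≡ suc m → Countℤ.count (± m) x ≡ 1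
count-± m (+ k)    refl = cong₂ _+_ (ind-yes (+ suc m ℤ.≟ + suc m) refl) (cong (_+ 0) (ind-no (-[1+ m ] ℤ.≟ + suc m) (λ ())))
count-± m -[1+ k ] refl = cong₂ _+_ (ind-no (+ suc k ℤ.≟ -[1+ k ]) (λ ())) (cong (_+ 0) (ind-yes (-[1+ k ] ℤ.≟ -[1+ k ]) refl))

ind-≟-subst : {A : Set} (_≟_ : DecidableEquality A) (Φ : A → ℕ) (w x : A) → Φ w * ind (w ≟ x) ≡ Φ x * ind (w ≟ x)
ind-≟-subst _≟_ Φ w x with w ≟ x
... | yes refl = refl
... | no _ = trans (ℕP.*-zeroʳ (Φ w)) (sym (ℕP.*-zeroʳ (Φ x)))

signedPerm-count : ∀ n x → IsSignedPerm n x → All (λ y → Countℤ.count (intRange n) y ≡ 1) x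
signedPerm-count n x (_ , bnd , _) = All.map (λ {y} (p , q) → count-intRange n y p q) bnd

count-signedPerms : ∀ n x → IsSignedPerm n x → Σ (allLists (intRange n) n) (λ w → ind (w ≟ℤ* x)) ≡ 1
count-signedPerms n x sp = trans (Countℤ.Σ-allLists-δ (intRange n) n x (signedPerm-count n x sp)) (ind-yes (length x ℕ.≟ n) (proj₁ sp))

Σ-δ-signedPerm : ∀ n x (Φ : List ℤ → ℕ) → IsSignedPerm n x →
  Σ (allLists (intRange n) n) (λ w → Φ w * ind (w ≟ℤ* x)) ≡ Φ x
Σ-δ-signedPerm n x Φ sp = begin
    Σ (allLists (intRange n) n) (λ w → Φ w * ind (w ≟ℤ* x))
  ≡⟨ Σ-ext (allLists (intRange n) n) (λ w → ind-≟-subst _≟ℤ*_ Φ w x) ⟩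
    Σ (allLists (intRange n) n) (λ w → Φ x * ind (w ≟ℤ* x))
  ≡⟨ Σ-*ˡ (allLists (intRange n) n) (Φ x) _ ⟩
    Φ x * Σ (allLists (intRange n) n) (λ w → ind (w ≟ℤ* x))
  ≡⟨ trans (cong (Φ x *_) (count-signedPerms n x sp)) (ℕP.*-identityʳ (Φ x)) ⟩
    Φ x ∎
  where open ≡-Reasoning

Σ³-separable : {A B C : Set} (xs : List A) (ys : List B) (zs : List C) (f : A → ℕ) (g : B → ℕ) (h : C → ℕ) →
  Σ xs (λ x → Σ ys (λ y → Σ zs (λ z → f x * (g y * h z)))) ≡ Σ xs f * (Σ ys g * Σ zs h)
Σ³-separable xs ys zs f g h = begin
    Σ xs (λ x → Σ ys (λ y → Σ zs (λ z → f x * (g y * h z))))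
  ≡⟨ Σ-ext xs (λ x → Σ-ext ys (λ y → trans (Σ-*ˡ zs (f x) _) (cong (f x *_) (Σ-*ˡ zs (g y) h)))) ⟩
    Σ xs (λ x → Σ ys (λ y → f x * (g y * Σ zs h)))
  ≡⟨ Σ-ext xs (λ x → trans (Σ-*ˡ ys (f x) _) (cong (f x *_) (Σ-*ʳ ys g (Σ zs h)))) ⟩
    Σ xs (λ x → f x * (Σ ys g * Σ zs h))
  ≡⟨ Σ-*ʳ xs f (Σ ys g * Σ zs h) ⟩
    Σ xs f * (Σ ys g * Σ zs h) ∎
  where open ≡-Reasoning

-- Every signed permutation of m+1 arises exactly once by inserting ±(m+1) at one of the
-- m+1 positions of a signed permutation of m.
module LargestEntry (m : ℕ) where
  n = suc m
  Wn = allLists (intRange n) n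
  Wm = allLists (intRange m) m
  P = upTo n

  insertions : List ℤ → ℕ
  insertions w = Σ P (λ p → Σ (± m) (λ v → Σ Wm (λ u → ind (isSignedPerm? m u) * ind (w ≟ℤ* insertAt p v u))))

  insertions-unsigned : ∀ w → ¬ IsSignedPerm n w → insertions w ≡ 0
  insertions-unsigned w ¬s = Σ-zero P (λ p mp → Σ-zero (± m) (λ v mv →
      trans (Σ-allLists-cong (intRange m) m (λ u lu → vanish p v u (∈-upTo⁻ mp) (±-abs m v mv) lu)) (Σ-zero Wm (λ _ _ → refl))))
    where
    vanish : ∀ p v u → p < n → ∣ v ∣ ≡ n → length u ≡ m → ind (isSignedPerm? m u) * ind (w ≟ℤ* insertAt p v u) ≡ 0
    vanish p v u pl av lu with isSignedPerm? m u | w ≟ℤ* insertAt p v u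
    ... | yes s | yes refl = ⊥-elim (¬s (insertAt-isSignedPerm m p v u s (subst (p ≤_) (sym lu) (ℕP.≤-pred pl)) av))
    ... | yes s | no _ = refl
    ... | no _ | _ = refl

  module _ (w : List ℤ) (lw : length w ≡ n) (s : IsSignedPerm n w) where
    private
      largest = signedPerm-surjective n w s n (s≤s z≤n) ℕP.≤-refl
      q0 = proj₁ largest
      q0<len : q0 < length w
      q0<len = proj₁ (proj₂ largest)
      v0 = entry w q0
      ∣v0∣ : ∣ v0 ∣ ≡ n
      ∣v0∣ = proj₂ (proj₂ largest)
      u0 = removeAt q0 w
      su0 : IsSignedPerm m u0
      su0 = removeAt-isSignedPerm m q0 w s q0<len ∣v0∣

    insertion-δ : ∀ p v u → p < n → ∣ v ∣ ≡ n → length u ≡ m →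
      ind (isSignedPerm? m u) * ind (w ≟ℤ* insertAt p v u) ≡ ind (p ℕ.≟ q0) * (ind (v ℤ.≟ v0) * ind (u ≟ℤ* u0))
    insertion-δ p v u pl av lu =
      trans (sym (ind-× (isSignedPerm? m u) (w ≟ℤ* insertAt p v u)))
      (trans (ind-⇔ (isSignedPerm? m u ×-dec (w ≟ℤ* insertAt p v u)) ((p ℕ.≟ q0) ×-dec ((v ℤ.≟ v0) ×-dec (u ≟ℤ* u0))) to from)
      (trans (ind-× (p ℕ.≟ q0) ((v ℤ.≟ v0) ×-dec (u ≟ℤ* u0))) (cong (ind (p ℕ.≟ q0) *_) (ind-× (v ℤ.≟ v0) (u ≟ℤ* u0)))))
      where
      p≤len : p ≤ length u
      p≤len = subst (p ≤_) (sym lu) (ℕP.≤-pred pl)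
      to : IsSignedPerm m u × w ≡ insertAt p v u → p ≡ q0 × v ≡ v0 × u ≡ u0
      to (su , refl) = p≡q0 , trans (sym (entry-insertAt p v u p≤len)) (cong (entry w) p≡q0)
                            , trans (sym (removeAt-insertAt p v u p≤len)) (cong (λ z → removeAt z w) p≡q0)
        where
        p≡q0 : p ≡ q0
        p≡q0 = absDistinct-position-unique w (proj₂ (proj₂ s)) p q0 (subst (p <_) (sym lw) pl) q0<len
                 (trans (cong ∣_∣ (entry-insertAt p v u p≤len)) (trans av (sym ∣v0∣)))
      from : p ≡ q0 × v ≡ v0 × u ≡ u0 → IsSignedPerm m u × w ≡ insertAt p v u
      from (refl , refl , refl) = su0 , sym (insertAt-removeAt q0 w q0<len)

    insertions-signed : insertions w ≡ 1
    insertions-signed = begin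
        insertions w
      ≡⟨ Σ-cong P (λ p mp → Σ-cong (± m) (λ v mv → Σ-allLists-cong (intRange m) m (λ u lu →
           insertion-δ p v u (∈-upTo⁻ mp) (±-abs m v mv) lu))) ⟩
        Σ P (λ p → Σ (± m) (λ v → Σ Wm (λ u → ind (p ℕ.≟ q0) * (ind (v ℤ.≟ v0) * ind (u ≟ℤ* u0)))))
      ≡⟨ Σ³-separable P (± m) Wm (λ p → ind (p ℕ.≟ q0)) (λ v → ind (v ℤ.≟ v0)) (λ u → ind (u ≟ℤ* u0)) ⟩
        Countℕ.count P q0 * (Countℤ.count (± m) v0 * Σ Wm (λ u → ind (u ≟ℤ* u0)))
      ≡⟨ cong₂ (λ a b → a * (b * Σ Wm (λ u → ind (u ≟ℤ* u0))))
               (count-upTo-< n q0 (subst (q0 <_) lw q0<len)) (count-± m v0 ∣v0∣) ⟩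
        1 * (1 * Σ Wm (λ u → ind (u ≟ℤ* u0)))
      ≡⟨ trans (ℕP.+-identityʳ _) (trans (ℕP.+-identityʳ _) (count-signedPerms m u0 su0)) ⟩
        1 ∎
      where open ≡-Reasoning

  insertions-count : ∀ w → length w ≡ n → insertions w ≡ ind (isSignedPerm? n w)
  insertions-count w lw with isSignedPerm? n w
  ... | yes s = insertions-signed w lw s
  ... | no ¬s = insertions-unsigned w ¬s

  Σ-by-largestEntry : (Φ : List ℤ → ℕ) → Σ Wn (λ w → ind (isSignedPerm? n w) * Φ w) ≡
    Σ P (λ p → Σ (± m) (λ v → Σ Wm (λ u → ind (isSignedPerm? m u) * Φ (insertAt p v u))))
  Σ-by-largestEntry Φ = sym (begin
      Σ P (λ p → Σ (± m) (λ v → Σ Wm (λ u → ind (isSignedPerm? m u) * Φ (insertAt p v u))))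
    ≡⟨ Σ-cong P (λ p mp → Σ-cong (± m) (λ v mv → Σ-allLists-cong (intRange m) m (λ u lu →
         spread p v u (∈-upTo⁻ mp) (±-abs m v mv) lu))) ⟩
      Σ P (λ p → Σ (± m) (λ v → Σ Wm (λ u → Σ Wn (T p v u))))
    ≡⟨ Σ-ext P (λ p → Σ-ext (± m) (λ v → Σ-swap Wm Wn (T p v))) ⟩
      Σ P (λ p → Σ (± m) (λ v → Σ Wn (λ w → Σ Wm (λ u → T p v u w))))
    ≡⟨ Σ-ext P (λ p → Σ-swap (± m) Wn (λ v w → Σ Wm (λ u → T p v u w))) ⟩
      Σ P (λ p → Σ Wn (λ w → Σ (± m) (λ v → Σ Wm (λ u → T p v u w))))
    ≡⟨ Σ-swap P Wn (λ p w → Σ (± m) (λ v → Σ Wm (λ u → T p v u w))) ⟩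
      Σ Wn (λ w → Σ P (λ p → Σ (± m) (λ v → Σ Wm (λ u → T p v u w))))
    ≡⟨ Σ-ext Wn (λ w → Σ-ext P (λ p → trans (Σ-ext (± m) (λ v → Σ-*ˡ Wm (Φ w) (λ u → δ p v u w))) (Σ-*ˡ (± m) (Φ w) (λ v → Σ Wm (λ u → δ p v u w))))) ⟩
      Σ Wn (λ w → Σ P (λ p → Φ w * Σ (± m) (λ v → Σ Wm (λ u → ind (isSignedPerm? m u) * ind (w ≟ℤ* insertAt p v u)))))
    ≡⟨ Σ-ext Wn (λ w → Σ-*ˡ P (Φ w) (λ p → Σ (± m) (λ v → Σ Wm (λ u → δ p v u w)))) ⟩
      Σ Wn (λ w → Φ w * insertions w)
    ≡⟨ Σ-allLists-cong (intRange n) n (λ w lw → trans (cong (Φ w *_) (insertions-count w lw)) (ℕP.*-comm (Φ w) _)) ⟩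
      Σ Wn (λ w → ind (isSignedPerm? n w) * Φ w) ∎)
    where
    open ≡-Reasoning
    δ : ℕ → ℤ → List ℤ → List ℤ → ℕ
    δ p v u w = ind (isSignedPerm? m u) * ind (w ≟ℤ* insertAt p v u)
    T : ℕ → ℤ → List ℤ → List ℤ → ℕ
    T p v u w = Φ w * δ p v u w
    spread : ∀ p v u → p < n → ∣ v ∣ ≡ n → length u ≡ m →
             ind (isSignedPerm? m u) * Φ (insertAt p v u) ≡ Σ Wn (T p v u)
    spread p v u pl av lu with isSignedPerm? m u
    ... | yes s = trans (ℕP.+-identityʳ _) (sym (trans (Σ-ext Wn (λ w → cong (Φ w *_) (ℕP.+-identityʳ _)))
                    (Σ-δ-signedPerm n (insertAt p v u) Φ (insertAt-isSignedPerm m p v u s (subst (p ≤_) (sym lu) (ℕP.≤-pred pl)) av))))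
    ... | no _ = sym (Σ-zero Wn (λ w _ → ℕP.*-zeroʳ (Φ w)))


-- Multinomial coefficients

-- choose a b = (a + b)! / (a! b!), by Pascal's rule.
choose : ℕ → ℕ → ℕ
choose zero b = 1
choose (suc a) zero = 1
choose (suc a) (suc b) = choose a (suc b) + choose (suc a) b

multi : List ℕ → ℕ
multi [] = 1
multi (b ∷ bs) = choose b (sum bs) * multi bs

-- The closed formula for ascendingCount below: entries sharing the block of the leading 0 must be
-- positive, every other entry has a free sign.
ascendingFormula : List ℕ → ℕ
ascendingFormula [] = 0
ascendingFormula (g ∷ rest) = 2 ^ sum rest * multi (g ∸ 1 ∷ rest)

-- shrinkLast γ q (shrinkFirst γ q) shortens the block of γ containing position q by one if q is
-- the last (first) position of that block, and is undefined otherwise: these are the positions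
-- where the largest entry n (resp. -n) can sit in a blockwise ascending word.
shrinkLast : List ℕ → ℕ → Maybe (List ℕ)
shrinkLast [] q = nothing
shrinkLast (b ∷ bs) q = if q <ᵇ b then (if suc q ≡ᵇ b then just (b ∸ 1 ∷ bs) else nothing) else Maybe.map (b ∷_) (shrinkLast bs (q ∸ b))

shrinkFirst : List ℕ → ℕ → Maybe (List ℕ)
shrinkFirst [] q = nothing
shrinkFirst (b ∷ bs) q = if q <ᵇ b then (if q ≡ᵇ 0 then just (b ∸ 1 ∷ bs) else nothing) else Maybe.map (b ∷_) (shrinkFirst bs (q ∸ b))

orZero : (List ℕ → ℕ) → Maybe (List ℕ) → ℕ
orZero F nothing = 0
orZero F (just δ) = F δ

orZero-map : ∀ F (f : List ℕ → List ℕ) r → orZero F (Maybe.map f r) ≡ orZero (λ δ → F (f δ)) r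
orZero-map F f nothing = refl
orZero-map F f (just x) = refl

<ᵇ-true : ∀ q b → q < b → (q <ᵇ b) ≡ true
<ᵇ-true zero (suc b) _ = refl
<ᵇ-true (suc q) (suc b) (s≤s p) = <ᵇ-true q b p

<ᵇ-false : ∀ q b → b ≤ q → (q <ᵇ b) ≡ false
<ᵇ-false q zero _ = refl
<ᵇ-false (suc q) (suc b) (s≤s p) = <ᵇ-false q b p

Σ-applyUpTo : ∀ (g h : ℕ → ℕ) (F F' : ℕ → ℕ) → (∀ i → F (g i) ≡ F' (h i)) → ∀ s → Σ (applyUpTo g s) F ≡ Σ (applyUpTo h s) F'
Σ-applyUpTo g h F F' e zero = refl
Σ-applyUpTo g h F F' e (suc s) = cong₂ _+_ (e 0) (Σ-applyUpTo (λ i → g (suc i)) (λ i → h (suc i)) F F' (λ i → e (suc i)) s)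

applyUpTo-+ : ∀ (f : ℕ → ℕ) b s → applyUpTo f (b + s) ≡ applyUpTo f b ++ applyUpTo (λ i → f (b + i)) s
applyUpTo-+ f zero s = refl
applyUpTo-+ f (suc b) s = cong (f 0 ∷_) (applyUpTo-+ (λ i → f (suc i)) b s)

Σ-upTo-+ : ∀ b s (F : ℕ → ℕ) → Σ (upTo (b + s)) F ≡ Σ (upTo b) F + Σ (upTo s) (λ i → F (b + i))
Σ-upTo-+ b s F = trans (cong (λ l → Σ l F) (applyUpTo-+ (λ i → i) b s))
  (trans (Σ-++ (upTo b) _ F) (cong (_+_ (Σ (upTo b) F)) (Σ-applyUpTo (λ i → b + i) (λ i → i) F (λ i → F (b + i)) (λ i → refl) s)))

Σ-shrink-split : ∀ (red : List ℕ → ℕ → Maybe (List ℕ)) (A : ℕ → List ℕ → List ℕ → Maybe (List ℕ)) →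
  (∀ b bs q → red (b ∷ bs) q ≡ (if q <ᵇ b then A q (b ∷ bs) bs else Maybe.map (b ∷_) (red bs (q ∸ b)))) →
  ∀ F b bs t → Σ (upTo (b + t)) (λ q → orZero F (red (b ∷ bs) q)) ≡
               Σ (upTo b) (λ q → orZero F (A q (b ∷ bs) bs)) + Σ (upTo t) (λ i → orZero (λ δ → F (b ∷ δ)) (red bs i))
Σ-shrink-split red A def F b bs t = trans (Σ-upTo-+ b t _) (cong₂ _+_
    (Σ-cong (upTo b) (λ q mq → cong (orZero F) (trans (def b bs q) (cong (λ c → if c then A q (b ∷ bs) bs else Maybe.map (b ∷_) (red bs (q ∸ b))) (<ᵇ-true q b (∈-upTo⁻ mq))))))
    (Σ-ext (upTo t) (λ i → trans (cong (orZero F) (trans (def b bs (b + i))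
        (trans (cong (λ c → if c then A (b + i) (b ∷ bs) bs else Maybe.map (b ∷_) (red bs ((b + i) ∸ b))) (<ᵇ-false (b + i) b (ℕP.m≤m+n b i)))
               (cong (λ z → Maybe.map (b ∷_) (red bs z)) (ℕP.m+n∸m≡n b i)))))
        (orZero-map F (b ∷_) (red bs i)))))

ifPositive : ℕ → ℕ → ℕ
ifPositive zero x = 0
ifPositive (suc _) x = x

≡ᵇ-refl : ∀ b → (b ≡ᵇ b) ≡ true
≡ᵇ-refl zero = refl
≡ᵇ-refl (suc b) = ≡ᵇ-refl b

≡ᵇ-false : ∀ q b → q < b → (q ≡ᵇ b) ≡ false
≡ᵇ-false zero (suc b) _ = refl
≡ᵇ-false (suc q) (suc b) (s≤s p) = ≡ᵇ-false q b p

Σ-shrinkLast-head : ∀ F X b → Σ (upTo b) (λ q → orZero F (if suc q ≡ᵇ b then just X else nothing)) ≡ ifPositive b (F X)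
Σ-shrinkLast-head F X zero = refl
Σ-shrinkLast-head F X (suc b) = trans (cong (λ l → Σ l G) (sym (LP.upTo-∷ʳ b))) (trans (Σ-++ (upTo b) (b ∷ []) G)
  (trans (cong₂ _+_ (Σ-cong (upTo b) (λ q mq → cong (λ c → orZero F (if c then just X else nothing)) (≡ᵇ-false q b (∈-upTo⁻ mq))))
                    (cong (λ c → orZero F (if c then just X else nothing) + 0) (≡ᵇ-refl b)))
         (trans (cong (_+ (F X + 0)) (Σ-zero (upTo b) (λ _ _ → refl))) (ℕP.+-identityʳ (F X)))))
  where
  G : ℕ → ℕ
  G q = orZero F (if q ≡ᵇ b then just X else nothing)

Σ-shrinkFirst-head : ∀ F X b → Σ (upTo b) (λ q → orZero F (if q ≡ᵇ 0 then just X else nothing)) ≡ ifPositive b (F X)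
Σ-shrinkFirst-head F X zero = refl
Σ-shrinkFirst-head F X (suc b) = trans (cong (_+_ (F X)) (trans (Σ-applyUpTo suc (λ i → i) _ (λ _ → 0) (λ i → refl) b) (Σ-zero (upTo b) (λ _ _ → refl)))) (ℕP.+-identityʳ (F X))

suc-pred : ∀ b → 1 ≤ b → suc (b ∸ 1) ≡ b
suc-pred (suc b) _ = refl

shrinkLast-sum : ∀ δ q δ' → shrinkLast δ q ≡ just δ' → suc (sum δ') ≡ sum δ
shrinkLast-sum [] q δ' ()
shrinkLast-sum (b ∷ bs) q δ' e with q <ᵇ b in lt
... | true with suc q ≡ᵇ b in eqb
...   | true with e
...     | refl = cong (_+ sum bs) (suc-pred b (ℕP.≤-trans (s≤s z≤n) (ℕP.<ᵇ⇒< q b (subst B.T (sym lt) _))))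
shrinkLast-sum (b ∷ bs) q δ' () | true | false
shrinkLast-sum (b ∷ bs) q δ' e | false with shrinkLast bs (q ∸ b) in er
... | just δ'' with e
...   | refl = trans (sym (ℕP.+-suc b (sum δ''))) (cong (_+_ b) (shrinkLast-sum bs (q ∸ b) δ'' er))
shrinkLast-sum (b ∷ bs) q δ' () | false | nothing

shrinkFirst-sum : ∀ δ q δ' → shrinkFirst δ q ≡ just δ' → suc (sum δ') ≡ sum δ
shrinkFirst-sum [] q δ' ()
shrinkFirst-sum (b ∷ bs) q δ' e with q <ᵇ b in lt
... | true with q ≡ᵇ 0
...   | true with e
...     | refl = cong (_+ sum bs) (suc-pred b (ℕP.≤-trans (s≤s z≤n) (ℕP.<ᵇ⇒< q b (subst B.T (sym lt) _))))
shrinkFirst-sum (b ∷ bs) q δ' () | true | false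
shrinkFirst-sum (b ∷ bs) q δ' e | false with shrinkFirst bs (q ∸ b) in er
... | just δ'' with e
...   | refl = trans (sym (ℕP.+-suc b (sum δ''))) (cong (_+_ b) (shrinkFirst-sum bs (q ∸ b) δ'' er))
shrinkFirst-sum (b ∷ bs) q δ' () | false | nothing

orZero-scale : ∀ (G : List ℕ → ℕ) c t r → (∀ δ' → r ≡ just δ' → sum δ' ≡ t) → (∀ δ' → sum δ' ≡ t → G δ' ≡ c * multi δ') → orZero G r ≡ c * orZero multi r
orZero-scale G c t nothing _ _ = sym (ℕP.*-zeroʳ c)
orZero-scale G c t (just δ') inv h = h δ' (inv δ' refl)

choose-0 : ∀ a → choose a 0 ≡ 1
choose-0 zero = refl
choose-0 (suc a) = refl

-- Pascal's rule for multinomials: multi δ is the sum of multi over all compositions obtained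
-- by shortening one block of δ by one, since each block is shortened at exactly one position.
module ShrinkSum (red : List ℕ → ℕ → Maybe (List ℕ)) (A : ℕ → List ℕ → List ℕ → Maybe (List ℕ))
  (def : ∀ b bs q → red (b ∷ bs) q ≡ (if q <ᵇ b then A q (b ∷ bs) bs else Maybe.map (b ∷_) (red bs (q ∸ b))))
  (first : ∀ F b bs → Σ (upTo b) (λ q → orZero F (A q (b ∷ bs) bs)) ≡ ifPositive b (F (b ∸ 1 ∷ bs)))
  (inv : ∀ δ q δ' → red δ q ≡ just δ' → suc (sum δ') ≡ sum δ) where

  Σ-shrink : ∀ δ s → sum δ ≡ suc s → Σ (upTo (suc s)) (λ q → orZero multi (red δ q)) ≡ multi δ
  Σ-shrink [] s ()
  Σ-shrink (b ∷ bs) s e = trans (cong (λ k → Σ (upTo k) (λ q → orZero multi (red (b ∷ bs) q))) (sym e))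
    (trans (Σ-shrink-split red A def multi b bs (sum bs)) (trans (cong (_+ Σ (upTo (sum bs)) (λ i → orZero (λ δ → multi (b ∷ δ)) (red bs i))) (first multi b bs))
    (by-sum (sum bs) refl)))
    where
    by-sum : ∀ t → sum bs ≡ t → ifPositive b (multi (b ∸ 1 ∷ bs)) + Σ (upTo t) (λ i → orZero (λ δ → multi (b ∷ δ)) (red bs i)) ≡ multi (b ∷ bs)
    by-sum zero et = trans (ℕP.+-identityʳ _) (fv b (sym e'))
      where
      e' : b ≡ suc s
      e' = trans (sym (ℕP.+-identityʳ b)) (trans (cong (_+_ b) (sym et)) e)
      fv : ∀ b → suc s ≡ b → ifPositive b (multi (b ∸ 1 ∷ bs)) ≡ multi (b ∷ bs)
      fv .(suc s) refl = cong (λ x → x * multi bs) (trans (cong (choose s) et) (trans (choose-0 s) (sym (cong (choose (suc s)) et))))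
    by-sum (suc t') et = trans (cong (_+_ (ifPositive b (multi (b ∸ 1 ∷ bs))))
        (trans (Σ-ext (upTo (suc t')) (λ i → orZero-scale (λ δ → multi (b ∷ δ)) (choose b t') t' (red bs i)
                   (λ δ' eq → ℕP.suc-injective (trans (inv bs i δ' eq) et)) (λ δ' sd → cong (λ z → choose b z * multi δ') sd)))
        (trans (Σ-*ˡ (upTo (suc t')) (choose b t') (λ i → orZero multi (red bs i))) (cong (choose b t' *_) (Σ-shrink bs t' et)))))
        (close b)
      where
      close : ∀ b → ifPositive b (multi (b ∸ 1 ∷ bs)) + choose b t' * multi bs ≡ multi (b ∷ bs)
      close zero = refl
      close (suc b') = trans (cong (λ z → choose b' z * multi bs + choose (suc b') t' * multi bs) et)
                       (trans (sym (ℕP.*-distribʳ-+ (multi bs) (choose b' (suc t')) (choose (suc b') t'))) (cong (λ z → choose (suc b') z * multi bs) (sym et)))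

Σ-shrinkLast : ∀ δ s → sum δ ≡ suc s → Σ (upTo (suc s)) (λ q → orZero multi (shrinkLast δ q)) ≡ multi δ
Σ-shrinkLast = ShrinkSum.Σ-shrink shrinkLast (λ q δ bs → if suc q ≡ᵇ hd δ then just (hd δ ∸ 1 ∷ bs) else nothing) (λ b bs q → refl)
       (λ F b bs → Σ-shrinkLast-head F (b ∸ 1 ∷ bs) b) shrinkLast-sum
  where
  hd : List ℕ → ℕ
  hd [] = 0
  hd (x ∷ _) = x

Σ-shrinkFirst : ∀ δ s → sum δ ≡ suc s → Σ (upTo (suc s)) (λ q → orZero multi (shrinkFirst δ q)) ≡ multi δ
Σ-shrinkFirst = ShrinkSum.Σ-shrink shrinkFirst (λ q δ bs → if q ≡ᵇ 0 then just (hd δ ∸ 1 ∷ bs) else nothing) (λ b bs q → refl)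
       (λ F b bs → Σ-shrinkFirst-head F (b ∸ 1 ∷ bs) b) shrinkFirst-sum
  where
  hd : List ℕ → ℕ
  hd [] = 0
  hd (x ∷ _) = x


ascendingFormula-recurrence : ∀ m g' rest → suc g' + sum rest ≡ suc (suc m) →
  Σ (upTo (suc m)) (λ p → orZero ascendingFormula (shrinkLast (suc g' ∷ rest) (suc p)) + (orZero ascendingFormula (shrinkFirst (suc g' ∷ rest) (suc p)) + 0)) ≡ ascendingFormula (suc g' ∷ rest)
ascendingFormula-recurrence m g' rest e = begin
    Σ (upTo (suc m)) term
  ≡⟨ cong (λ k → Σ (upTo k) term) (sym e-pred) ⟩
    Σ (upTo (g' + s)) term
  ≡⟨ Σ-upTo-+ g' s term ⟩
    Σ (upTo g') term + Σ (upTo s) (λ i → term (g' + i))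
  ≡⟨ cong₂ _+_ (trans (Σ-cong (upTo g') (λ p mp → term-firstBlock p (∈-upTo⁻ mp))) (Σ-shrinkLast-head ascendingFormula (g' ∷ rest) g'))
               (Σ-ext (upTo s) term-laterBlocks) ⟩
    ifPositive g' (ascendingFormula (g' ∷ rest)) + Σ (upTo s) (λ i → orZero (λ δ → ascendingFormula (suc g' ∷ δ)) (shrinkLast rest i) + (orZero (λ δ → ascendingFormula (suc g' ∷ δ)) (shrinkFirst rest i) + 0))
  ≡⟨ by-sum s refl ⟩
    ascendingFormula (suc g' ∷ rest) ∎
  where
  open ≡-Reasoning
  s = sum rest
  e-pred : g' + s ≡ suc m
  e-pred = ℕP.suc-injective e
  γ = suc g' ∷ rest
  term : ℕ → ℕ
  term p = orZero ascendingFormula (shrinkLast γ (suc p)) + (orZero ascendingFormula (shrinkFirst γ (suc p)) + 0)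
  term-firstBlock : ∀ p → p < g' → term p ≡ orZero ascendingFormula (if suc p ≡ᵇ g' then just (g' ∷ rest) else nothing)
  term-firstBlock p pl rewrite <ᵇ-true p g' pl = ℕP.+-identityʳ _
  term-laterBlocks : ∀ i → term (g' + i) ≡ orZero (λ δ → ascendingFormula (suc g' ∷ δ)) (shrinkLast rest i) + (orZero (λ δ → ascendingFormula (suc g' ∷ δ)) (shrinkFirst rest i) + 0)
  term-laterBlocks i rewrite <ᵇ-false (g' + i) g' (ℕP.m≤m+n g' i) | ℕP.m+n∸m≡n g' i =
    cong₂ (λ a b → a + (b + 0)) (orZero-map ascendingFormula (suc g' ∷_) (shrinkLast rest i)) (orZero-map ascendingFormula (suc g' ∷_) (shrinkFirst rest i))
  by-sum : ∀ t → s ≡ t → ifPositive g' (ascendingFormula (g' ∷ rest)) + Σ (upTo t) (λ i → orZero (λ δ → ascendingFormula (suc g' ∷ δ)) (shrinkLast rest i) + (orZero (λ δ → ascendingFormula (suc g' ∷ δ)) (shrinkFirst rest i) + 0)) ≡ ascendingFormula (suc g' ∷ rest)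
  by-sum zero et = trans (ℕP.+-identityʳ _) (single-block g' (trans (sym (ℕP.+-identityʳ g')) (trans (cong (_+_ g') (sym et)) e-pred)))
    where
    single-block : ∀ g' → g' ≡ suc m → ifPositive g' (ascendingFormula (g' ∷ rest)) ≡ ascendingFormula (suc g' ∷ rest)
    single-block .(suc m) refl = trans (cong (λ z → 2 ^ z * (choose m z * multi rest)) et)
      (trans (cong (λ x → 1 * (x * multi rest)) (trans (choose-0 m) (sym (choose-0 (suc m))))) (sym (cong (λ z → 2 ^ z * (choose (suc m) z * multi rest)) et)))
  by-sum (suc s') et = begin
      ifPositive g' (ascendingFormula (g' ∷ rest)) + Σ (upTo (suc s')) (λ i → orZero withFirst (shrinkLast rest i) + (orZero withFirst (shrinkFirst rest i) + 0))
    ≡⟨ cong (_+_ (ifPositive g' (ascendingFormula (g' ∷ rest)))) (trans (Σ-ext (upTo (suc s')) term-scaled)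
         (trans (Σ-*ˡ (upTo (suc s')) c (λ i → orZero multi (shrinkLast rest i) + orZero multi (shrinkFirst rest i))) (cong (c *_) (trans (Σ-+ (upTo (suc s')) (λ i → orZero multi (shrinkLast rest i)) (λ i → orZero multi (shrinkFirst rest i))) (cong₂ _+_ (Σ-shrinkLast rest s' et) (Σ-shrinkFirst rest s' et)))))) ⟩
      ifPositive g' (ascendingFormula (g' ∷ rest)) + c * (multi rest + multi rest)
    ≡⟨ pascal g' ⟩
      ascendingFormula (suc g' ∷ rest) ∎
    where
    withFirst : List ℕ → ℕ
    withFirst δ = ascendingFormula (suc g' ∷ δ)
    c = 2 ^ s' * choose g' s'
    scaled : ∀ r → (∀ δ' → r ≡ just δ' → suc (sum δ') ≡ sum rest) → orZero withFirst r ≡ c * orZero multi r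
    scaled r inv = orZero-scale withFirst c s' r (λ δ' eq → ℕP.suc-injective (trans (inv δ' eq) et))
                 (λ δ' sd → trans (cong (λ z → 2 ^ z * (choose g' z * multi δ')) sd) (sym (ℕP.*-assoc (2 ^ s') (choose g' s') (multi δ'))))
    term-scaled : ∀ i → orZero withFirst (shrinkLast rest i) + (orZero withFirst (shrinkFirst rest i) + 0) ≡ c * (orZero multi (shrinkLast rest i) + orZero multi (shrinkFirst rest i))
    term-scaled i = trans (cong₂ (λ a b → a + b) (scaled (shrinkLast rest i) (shrinkLast-sum rest i)) (trans (ℕP.+-identityʳ _) (scaled (shrinkFirst rest i) (shrinkFirst-sum rest i))))
                 (sym (ℕP.*-distribˡ-+ c _ _))
    pascal : ∀ g' → ifPositive g' (ascendingFormula (g' ∷ rest)) + (2 ^ s' * choose g' s') * (multi rest + multi rest) ≡ ascendingFormula (suc g' ∷ rest)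
    pascal zero = trans (double-base (2 ^ s') (multi rest)) (cong (λ z → 2 ^ z * (1 * multi rest)) (sym et))
      where
      double-base : ∀ P X → 0 + (P * 1) * (X + X) ≡ (2 * P) * (1 * X)
      double-base = solve-∀
    pascal (suc g'') = trans (cong (λ z → 2 ^ z * (choose g'' z * multi rest) + (2 ^ s' * choose (suc g'') s') * (multi rest + multi rest)) et)
      (trans (double-step (2 ^ s') (choose g'' (suc s')) (choose (suc g'') s') (multi rest))
             (cong (λ z → 2 ^ z * (choose (suc g'') z * multi rest)) (sym et)))
      where
      double-step : ∀ P a b X → (2 * P) * (a * X) + (P * b) * (X + X) ≡ (2 * P) * ((a + b) * X)
      double-step = solve-∀


choose-factorial : ∀ a b → choose a b * (a ! * b !) ≡ (a + b) !
choose-factorial zero b = trans (ℕP.*-identityˡ _) (ℕP.*-identityˡ _)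
choose-factorial (suc a) zero = trans (ℕP.+-identityʳ _) (trans (ℕP.*-identityʳ ((suc a) !)) (cong _! (sym (ℕP.+-identityʳ (suc a)))))
choose-factorial (suc a) (suc b) = begin
    (X + Y) * ((suc a * A) * (suc b * B))
  ≡⟨ rearrange X Y A B a b ⟩
    suc a * (X * (A * (suc b * B))) + suc b * (Y * ((suc a * A) * B))
  ≡⟨ cong₂ (λ u v → suc a * u + suc b * v) (trans (choose-factorial a (suc b)) (cong _! (ℕP.+-suc a b))) (choose-factorial (suc a) b) ⟩
    suc a * F + suc b * F
  ≡⟨ collect a b F ⟩
    (suc (suc (a + b))) * F
  ≡⟨ sym (cong (λ z → suc z * z !) (ℕP.+-suc a b)) ⟩
    (suc a + suc b) ! ∎
  where
  open ≡-Reasoning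
  X = choose a (suc b)
  Y = choose (suc a) b
  A = a !
  B = b !
  F = (suc a + b) !
  rearrange : ∀ X Y A B a b → (X + Y) * ((suc a * A) * (suc b * B)) ≡ suc a * (X * (A * (suc b * B))) + suc b * (Y * ((suc a * A) * B))
  rearrange = solve-∀
  collect : ∀ a b F → suc a * F + suc b * F ≡ suc (suc (a + b)) * F
  collect = solve-∀

multi-factorial : ∀ β → multi β * prodFact β ≡ (sum β) !
multi-factorial [] = refl
multi-factorial (b ∷ bs) = begin
    choose b (sum bs) * multi bs * (b ! * prodFact bs)
  ≡⟨ rearrange (choose b (sum bs)) (multi bs) (b !) (prodFact bs) ⟩
    choose b (sum bs) * (b ! * (multi bs * prodFact bs))
  ≡⟨ cong (λ z → choose b (sum bs) * (b ! * z)) (multi-factorial bs) ⟩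
    choose b (sum bs) * (b ! * (sum bs) !)
  ≡⟨ choose-factorial b (sum bs) ⟩
    (b + sum bs) ! ∎
  where
  open ≡-Reasoning
  rearrange : ∀ x y z w → x * y * (z * w) ≡ x * (z * (y * w))
  rearrange = solve-∀

multinomial≡multi : ∀ n β → sum β ≡ n → multinomial n β ≡ multi β
multinomial≡multi n β e = trans (cong (λ k → (k ! / prodFact β) {{prodFact-nonZero β}}) (sym e))
  (trans (cong (λ k → (k / prodFact β) {{prodFact-nonZero β}}) (sym (multi-factorial β))) (ℕ.m*n/n≡m (multi β) (prodFact β) {{prodFact-nonZero β}}))


-- Signed permutations increasing on blocks

leqᵇ : ℤ → ℤ → Bool
leqᵇ x y = does (x ℤ.≤? y)

ascendingFrom : ℤ → List ℤ → Bool
ascendingFrom x [] = true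
ascendingFrom x (y ∷ l) = leqᵇ x y ∧ ascendingFrom y l

ascending : List ℤ → Bool
ascending [] = true
ascending (x ∷ l) = ascendingFrom x l

blockwiseAscending : List ℕ → List ℤ → Bool
blockwiseAscending [] w = true
blockwiseAscending (b ∷ bs) w = ascending (take b w) ∧ blockwiseAscending bs (drop b w)

leqᵇ-true : ∀ {x y} → x ℤ.≤ y → leqᵇ x y ≡ true
leqᵇ-true {x} {y} = dec-true (x ℤ.≤? y)

leqᵇ-false : ∀ {x y} → y ℤ.< x → leqᵇ x y ≡ false
leqᵇ-false {x} {y} p = dec-false (x ℤ.≤? y) (ℤP.<⇒≱ p)

∧-swap : ∀ a b c → a ∧ (b ∧ c) ≡ b ∧ (a ∧ c)
∧-swap true b c = refl
∧-swap false true c = refl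
∧-swap false false c = refl

module InsertTop (top : ℤ) where
  ascendingFrom-insertTop : ∀ x q L → x ℤ.≤ top → All (λ y → y ℤ.< top) L → q ≤ length L → ascendingFrom x (insertAt q top L) ≡ (q ≡ᵇ length L) ∧ ascendingFrom x L
  ascendingFrom-insertTop x zero [] xt _ _ = cong (_∧ true) (leqᵇ-true xt)
  ascendingFrom-insertTop x zero (y ∷ L) xt (yt ∷ _) _ = trans (cong (_∧ (leqᵇ top y ∧ ascendingFrom y L)) (leqᵇ-true xt)) (cong (_∧ ascendingFrom y L) (leqᵇ-false yt))
  ascendingFrom-insertTop x (suc q) (y ∷ L) xt (yt ∷ al) (s≤s ql) =
    trans (cong (leqᵇ x y ∧_) (ascendingFrom-insertTop y q L (ℤP.<⇒≤ yt) al ql)) (∧-swap (leqᵇ x y) (q ≡ᵇ length L) (ascendingFrom y L))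

  ascending-insertTop : ∀ q L → All (λ y → y ℤ.< top) L → q ≤ length L → ascending (insertAt q top L) ≡ (q ≡ᵇ length L) ∧ ascending L
  ascending-insertTop zero [] _ _ = refl
  ascending-insertTop zero (y ∷ L) (yt ∷ _) _ = cong (_∧ ascendingFrom y L) (leqᵇ-false yt)
  ascending-insertTop (suc q) (y ∷ L) (yt ∷ al) (s≤s ql) = ascendingFrom-insertTop y q L (ℤP.<⇒≤ yt) al ql

module InsertBottom (bot : ℤ) where
  ascendingFrom-insertBottom : ∀ y q L → bot ℤ.< y → All (λ z → bot ℤ.< z) L → ascendingFrom y (insertAt q bot L) ≡ false
  ascendingFrom-insertBottom y zero L by _ = cong (_∧ ascendingFrom bot L) (leqᵇ-false by)
  ascendingFrom-insertBottom y (suc q) [] by _ = cong (_∧ true) (leqᵇ-false by)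
  ascendingFrom-insertBottom y (suc q) (z ∷ L) by (bz ∷ al) = trans (cong (leqᵇ y z ∧_) (ascendingFrom-insertBottom z q L bz al)) (∧-zeroʳ (leqᵇ y z))

  ascendingFrom-below : ∀ x L → All (λ z → x ℤ.< z) L → ascendingFrom x L ≡ ascending L
  ascendingFrom-below x [] _ = refl
  ascendingFrom-below x (y ∷ L) (xy ∷ _) = cong (_∧ ascendingFrom y L) (leqᵇ-true (ℤP.<⇒≤ xy))

  ascending-insertBottom : ∀ q L → All (λ z → bot ℤ.< z) L → q ≤ length L → ascending (insertAt q bot L) ≡ (q ≡ᵇ 0) ∧ ascending L
  ascending-insertBottom zero L al _ = ascendingFrom-below bot L al
  ascending-insertBottom (suc q) (y ∷ L) (by ∷ al) _ = ascendingFrom-insertBottom y q L by al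

take-insertAt-< : ∀ q b v u → q < b → take b (insertAt q v u) ≡ insertAt q v (take (b ∸ 1) u)
take-insertAt-< zero (suc b) v u _ = refl
take-insertAt-< (suc q) (suc (suc b)) v [] (s≤s (s≤s _)) = refl
take-insertAt-< (suc q) (suc (suc b)) v (x ∷ u) (s≤s ql) = cong (x ∷_) (take-insertAt-< q (suc b) v u ql)

drop-insertAt-< : ∀ q b v u → q < b → drop b (insertAt q v u) ≡ drop (b ∸ 1) u
drop-insertAt-< zero (suc b) v u _ = refl
drop-insertAt-< (suc q) (suc (suc b)) v [] (s≤s (s≤s _)) = refl
drop-insertAt-< (suc q) (suc (suc b)) v (x ∷ u) (s≤s ql) = drop-insertAt-< q (suc b) v u ql

take-insertAt-≥ : ∀ q b v u → b ≤ q → b ≤ length u → take b (insertAt q v u) ≡ take b u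
take-insertAt-≥ q zero v u _ _ = refl
take-insertAt-≥ (suc q) (suc b) v (x ∷ u) (s≤s bq) (s≤s bl) = cong (x ∷_) (take-insertAt-≥ q b v u bq bl)

drop-insertAt-≥ : ∀ q b v u → b ≤ q → b ≤ length u → drop b (insertAt q v u) ≡ insertAt (q ∸ b) v (drop b u)
drop-insertAt-≥ q zero v u _ _ = refl
drop-insertAt-≥ (suc q) (suc b) v (x ∷ u) (s≤s bq) (s≤s bl) = drop-insertAt-≥ q b v u bq bl

orFalse : (List ℕ → Bool) → Maybe (List ℕ) → Bool
orFalse f nothing = false
orFalse f (just δ) = f δ

length-take≤ : ∀ b (u : List ℤ) → b ≤ length u → length (take b u) ≡ b
length-take≤ zero u _ = refl
length-take≤ (suc b) (x ∷ u) (s≤s p) = cong suc (length-take≤ b u p)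

orFalse-map : ∀ (f : List ℕ → Bool) b (A : Bool) (g : List ℕ → Bool) r → (∀ δ → f (b ∷ δ) ≡ A ∧ g δ) →
  orFalse f (Maybe.map (b ∷_) r) ≡ A ∧ orFalse g r
orFalse-map f b A g nothing h = sym (∧-zeroʳ A)
orFalse-map f b A g (just δ) h = h δ

module InsertBlockwise (v : ℤ) (red : List ℕ → ℕ → Maybe (List ℕ)) (cond : ℕ → ℕ → Bool)
  (def : ∀ b bs q → red (b ∷ bs) q ≡ (if q <ᵇ b then (if cond q b then just (b ∸ 1 ∷ bs) else nothing) else Maybe.map (b ∷_) (red bs (q ∸ b))))
  (V : ℤ → Set)
  (first : ∀ q L → All V L → q ≤ length L → ascending (insertAt q v L) ≡ (cond q (suc (length L))) ∧ ascending L) where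

  blockwiseAscending-insertAt : ∀ γ q u → sum γ ≡ suc (length u) → q ≤ length u → All V u → blockwiseAscending γ (insertAt q v u) ≡ orFalse (λ δ → blockwiseAscending δ u) (red γ q)
  blockwiseAscending-insertAt [] q u () ql al
  blockwiseAscending-insertAt (b ∷ bs) q u e ql al with q ℕ.<? b
  ... | yes qb = trans lhs (sym (trans (cong (orFalse (λ δ → blockwiseAscending δ u)) (def b bs q)) (cong (λ c → orFalse (λ δ → blockwiseAscending δ u) (if c then (if cond q b then just (b ∸ 1 ∷ bs) else nothing) else Maybe.map (b ∷_) (red bs (q ∸ b)))) (<ᵇ-true q b qb))))
    where
    b1 : suc (b ∸ 1) ≡ b
    b1 = suc-pred b (ℕP.≤-trans (s≤s z≤n) qb)
    bl : b ∸ 1 ≤ length u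
    bl = ℕP.≤-pred (subst (_≤ suc (length u)) (sym b1) (subst (b ≤_) e (ℕP.m≤m+n b (sum bs))))
    lt : length (take (b ∸ 1) u) ≡ b ∸ 1
    lt = length-take≤ (b ∸ 1) u bl
    qt : q ≤ length (take (b ∸ 1) u)
    qt = subst (q ≤_) (sym lt) (ℕP.≤-pred (subst (q <_) (sym b1) qb))
    close : ∀ c → (c ∧ ascending (take (b ∸ 1) u)) ∧ blockwiseAscending bs (drop (b ∸ 1) u) ≡ orFalse (λ δ → blockwiseAscending δ u) (if c then just (b ∸ 1 ∷ bs) else nothing)
    close true = refl
    close false = refl
    lhs : blockwiseAscending (b ∷ bs) (insertAt q v u) ≡ orFalse (λ δ → blockwiseAscending δ u) (if cond q b then just (b ∸ 1 ∷ bs) else nothing)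
    lhs = trans (cong₂ _∧_ (trans (cong ascending (take-insertAt-< q b v u qb)) (first q (take (b ∸ 1) u) (take⁺ (b ∸ 1) al) qt)) (cong (blockwiseAscending bs) (drop-insertAt-< q b v u qb)))
          (trans (cong (λ k → (cond q k ∧ ascending (take (b ∸ 1) u)) ∧ blockwiseAscending bs (drop (b ∸ 1) u)) (trans (cong suc lt) b1)) (close (cond q b)))
  ... | no ¬qb = trans lhs (sym (trans (cong (orFalse (λ δ → blockwiseAscending δ u)) (def b bs q)) (trans (cong (λ c → orFalse (λ δ → blockwiseAscending δ u) (if c then (if cond q b then just (b ∸ 1 ∷ bs) else nothing) else Maybe.map (b ∷_) (red bs (q ∸ b)))) (<ᵇ-false q b bq))
            (orFalse-map (λ δ → blockwiseAscending δ u) b (ascending (take b u)) (λ δ → blockwiseAscending δ (drop b u)) (red bs (q ∸ b)) (λ δ → refl)))))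
    where
    bq : b ≤ q
    bq = ℕP.≮⇒≥ ¬qb
    bl : b ≤ length u
    bl = ℕP.≤-trans bq ql
    e' : sum bs ≡ suc (length (drop b u))
    e' = trans (sym (ℕP.m+n∸m≡n b (sum bs))) (trans (cong (_∸ b) e) (trans (ℕP.+-∸-assoc 1 bl) (cong suc (sym (LP.length-drop b u)))))
    ql' : q ∸ b ≤ length (drop b u)
    ql' = subst (q ∸ b ≤_) (sym (LP.length-drop b u)) (ℕP.∸-monoˡ-≤ b ql)
    lhs : blockwiseAscending (b ∷ bs) (insertAt q v u) ≡ ascending (take b u) ∧ orFalse (λ δ → blockwiseAscending δ (drop b u)) (red bs (q ∸ b))
    lhs = cong₂ _∧_ (cong ascending (take-insertAt-≥ q b v u bq bl)) (trans (cong (blockwiseAscending bs) (drop-insertAt-≥ q b v u bq bl)) (blockwiseAscending-insertAt bs (q ∸ b) (drop b u) e' ql' (drop⁺ b al)))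


module InsertTopBlockwise (m : ℕ) = InsertBlockwise (+ suc m) shrinkLast (λ q b → suc q ≡ᵇ b) (λ b bs q → refl) (λ y → y ℤ.< + suc m) (λ q L al ql → InsertTop.ascending-insertTop (+ suc m) q L al ql)
module InsertBottomBlockwise (m : ℕ) = InsertBlockwise -[1+ m ] shrinkFirst (λ q b → q ≡ᵇ 0) (λ b bs q → refl) (λ y → -[1+ m ] ℤ.< y) (λ q L al ql → InsertBottom.ascending-insertBottom -[1+ m ] q L al ql)

abs≤⇒<top : ∀ y m → ∣ y ∣ ≤ m → y ℤ.< + suc m
abs≤⇒<top (+ k) m p = ℤ.+<+ (s≤s p)
abs≤⇒<top -[1+ k ] m p = ℤ.-<+

abs≤⇒>bottom : ∀ y m → ∣ y ∣ ≤ m → -[1+ m ] ℤ.< y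
abs≤⇒>bottom (+ k) m p = ℤ.-<+
abs≤⇒>bottom -[1+ k ] m (s≤s p) = ℤ.-<- (s≤s p)

-- The leading 0 forces the entries sharing the first block of γ to be positive.
ascendingCount : ℕ → List ℕ → ℕ
ascendingCount n γ = Σ (allLists (intRange n) n) (λ w → ind (isSignedPerm? n w) * boolToℕ (blockwiseAscending γ (+ 0 ∷ w)))

-- Classify by the position of the entry ±(m+1): +(m+1) has to end its block, -(m+1) to start it.
ascendingCount-recurrence : ∀ m γ → sum γ ≡ suc (suc m) →
  ascendingCount (suc m) γ ≡ Σ (upTo (suc m)) (λ p → orZero (ascendingCount m) (shrinkLast γ (suc p)) + (orZero (ascendingCount m) (shrinkFirst γ (suc p)) + 0))
ascendingCount-recurrence m γ e = trans (LargestEntry.Σ-by-largestEntry m (λ w → boolToℕ (blockwiseAscending γ (+ 0 ∷ w))))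
  (Σ-cong (upTo (suc m)) (λ p mp → cong₂ (λ a b → a + (b + 0))
     (insertions-of (+ suc m) shrinkLast (λ y → y ℤ.< + suc m) (abs≤⇒<top (+ 0) m z≤n) (λ y q → abs≤⇒<top y m q) p (λ u l al → InsertTopBlockwise.blockwiseAscending-insertAt m γ (suc p) (+ 0 ∷ u) (trans e (cong (λ k → suc (suc k)) (sym l))) (s≤s (subst (p ≤_) (sym l) (ℕP.≤-pred (∈-upTo⁻ mp)))) al))
     (insertions-of -[1+ m ] shrinkFirst (λ y → -[1+ m ] ℤ.< y) (abs≤⇒>bottom (+ 0) m z≤n) (λ y q → abs≤⇒>bottom y m q) p (λ u l al → InsertBottomBlockwise.blockwiseAscending-insertAt m γ (suc p) (+ 0 ∷ u) (trans e (cong (λ k → suc (suc k)) (sym l))) (s≤s (subst (p ≤_) (sym l) (ℕP.≤-pred (∈-upTo⁻ mp)))) al))))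
  where
  Wm = allLists (intRange m) m
  insertions-of : ∀ v (red : List ℕ → ℕ → Maybe (List ℕ)) (V : ℤ → Set) → V (+ 0) → (∀ y → ∣ y ∣ ≤ m → V y) → ∀ p →
    (∀ u → length u ≡ m → All V (+ 0 ∷ u) → blockwiseAscending γ (insertAt (suc p) v (+ 0 ∷ u)) ≡ orFalse (λ δ → blockwiseAscending δ (+ 0 ∷ u)) (red γ (suc p))) →
    Σ Wm (λ u → ind (isSignedPerm? m u) * boolToℕ (blockwiseAscending γ (+ 0 ∷ insertAt p v u))) ≡ orZero (ascendingCount m) (red γ (suc p))
  insertions-of v red V v0 vb p il = trans (Σ-allLists-cong (intRange m) m (λ u l → by-sign u l (isSignedPerm? m u))) (by-shrink (red γ (suc p)))
    where
    by-sign : ∀ u → length u ≡ m → (d : Dec (IsSignedPerm m u)) → ind d * boolToℕ (blockwiseAscending γ (+ 0 ∷ insertAt p v u)) ≡ ind d * boolToℕ (orFalse (λ δ → blockwiseAscending δ (+ 0 ∷ u)) (red γ (suc p)))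
    by-sign u l (yes s) = cong (λ z → boolToℕ z + 0) (il u l (v0 ∷ All.map (λ {y} (_ , q) → vb y q) (proj₁ (proj₂ s))))
    by-sign u l (no _) = refl
    by-shrink : ∀ r → Σ Wm (λ u → ind (isSignedPerm? m u) * boolToℕ (orFalse (λ δ → blockwiseAscending δ (+ 0 ∷ u)) r)) ≡ orZero (ascendingCount m) r
    by-shrink nothing = Σ-zero Wm (λ u _ → ℕP.*-zeroʳ (ind (isSignedPerm? m u)))
    by-shrink (just δ) = refl

HeadPositive : List ℕ → Set
HeadPositive [] = ⊥
HeadPositive (h ∷ _) = 1 ≤ h

blockwiseAscending-[] : ∀ γ → blockwiseAscending γ [] ≡ true
blockwiseAscending-[] [] = refl
blockwiseAscending-[] (zero ∷ bs) = blockwiseAscending-[] bs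
blockwiseAscending-[] (suc b ∷ bs) = blockwiseAscending-[] bs

multi-sum0 : ∀ rest → sum rest ≡ 0 → multi rest ≡ 1
multi-sum0 [] _ = refl
multi-sum0 (zero ∷ bs) e = trans (ℕP.+-identityʳ (multi bs)) (multi-sum0 bs e)

shrinkLast-HeadPositive : ∀ g' rest p δ → shrinkLast (suc g' ∷ rest) (suc p) ≡ just δ → HeadPositive δ
shrinkLast-HeadPositive g' rest p δ e with p <ᵇ g' in lt
... | true with suc p ≡ᵇ g' in eq
...   | true with e
...     | refl = subst (1 ≤_) (ℕP.≡ᵇ⇒≡ (suc p) g' (subst B.T (sym eq) _)) (s≤s z≤n)
shrinkLast-HeadPositive g' rest p δ () | true | false
shrinkLast-HeadPositive g' rest p δ e | false with shrinkLast rest (p ∸ g')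
... | just x with e
...   | refl = s≤s z≤n
shrinkLast-HeadPositive g' rest p δ () | false | nothing

shrinkFirst-HeadPositive : ∀ g' rest p δ → shrinkFirst (suc g' ∷ rest) (suc p) ≡ just δ → HeadPositive δ
shrinkFirst-HeadPositive g' rest p δ e with p <ᵇ g'
shrinkFirst-HeadPositive g' rest p δ () | true
... | false with shrinkFirst rest (p ∸ g')
... | just x with e
...   | refl = s≤s z≤n
shrinkFirst-HeadPositive g' rest p δ () | false | nothing

ascendingCount≡formula : ∀ m γ → sum γ ≡ suc m → HeadPositive γ → ascendingCount m γ ≡ ascendingFormula γ
ascendingCount≡formula m [] e ()
ascendingCount≡formula zero (suc zero ∷ rest) e _ = trans (cong (λ z → 1 * boolToℕ z + 0) (blockwiseAscending-[] rest))
  (sym (trans (cong (λ z → 2 ^ z * multi (0 ∷ rest)) rest-empty) (trans (ℕP.+-identityʳ _) (trans (ℕP.+-identityʳ _) (multi-sum0 rest rest-empty)))))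
  where
  rest-empty : sum rest ≡ 0
  rest-empty = ℕP.suc-injective e
ascendingCount≡formula zero (suc (suc g) ∷ rest) () _
ascendingCount≡formula (suc m) (suc g' ∷ rest) e _ = trans (ascendingCount-recurrence m (suc g' ∷ rest) e)
  (trans (Σ-ext (upTo (suc m)) (λ p → cong₂ (λ a b → a + (b + 0))
            (inductive-step shrinkLast shrinkLast-sum (shrinkLast-HeadPositive g' rest p) (suc p) refl) (inductive-step shrinkFirst shrinkFirst-sum (shrinkFirst-HeadPositive g' rest p) (suc p) refl)))
         (ascendingFormula-recurrence m g' rest e))
  where
  inductive-step : ∀ (red : List ℕ → ℕ → Maybe (List ℕ)) → (∀ δ q δ' → red δ q ≡ just δ' → suc (sum δ') ≡ sum δ) → ∀ {q} → (∀ δ → red (suc g' ∷ rest) q ≡ just δ → HeadPositive δ) →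
       ∀ q' → q' ≡ q → orZero (ascendingCount m) (red (suc g' ∷ rest) q) ≡ orZero ascendingFormula (red (suc g' ∷ rest) q)
  inductive-step red inv {q} hp .q refl with red (suc g' ∷ rest) q in eq
  ... | nothing = refl
  ... | just δ = ascendingCount≡formula m δ (ℕP.suc-injective (trans (inv _ q δ eq) e)) (hp δ refl)


Σ-allLists-map : ∀ {A : Set} (xs : List A) (f : A → A) → (∀ (h : A → ℕ) → Σ xs (λ x → h (f x)) ≡ Σ xs h) →
  ∀ k (F : List A → ℕ) → Σ (allLists xs k) (λ w → F (map f w)) ≡ Σ (allLists xs k) F
Σ-allLists-map xs f inv zero F = refl
Σ-allLists-map xs f inv (suc k) F = begin
    Σ (allLists xs (suc k)) (λ w → F (map f w))
  ≡⟨ Σ-allLists-suc xs k _ ⟩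
    Σ xs (λ x → Σ (allLists xs k) (λ w → F (f x ∷ map f w)))
  ≡⟨ Σ-ext xs (λ x → Σ-allLists-map xs f inv k (λ w → F (f x ∷ w))) ⟩
    Σ xs (λ x → Σ (allLists xs k) (λ w → F (f x ∷ w)))
  ≡⟨ inv (λ y → Σ (allLists xs k) (λ w → F (y ∷ w))) ⟩
    Σ xs (λ x → Σ (allLists xs k) (λ w → F (x ∷ w)))
  ≡⟨ sym (Σ-allLists-suc xs k F) ⟩
    Σ (allLists xs (suc k)) F ∎
  where open ≡-Reasoning

negateFirst : List ℤ → List ℤ
negateFirst [] = []
negateFirst (x ∷ w) = ℤ.- x ∷ w

Σ-allLists-negateFirst : ∀ n k (F : List ℤ → ℕ) → (∀ (h : ℤ → ℕ) → Σ (intRange n) (λ x → h (ℤ.- x)) ≡ Σ (intRange n) h) →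
  Σ (allLists (intRange n) (suc k)) (λ w → F (negateFirst w)) ≡ Σ (allLists (intRange n) (suc k)) F
Σ-allLists-negateFirst n k F inv = trans (Σ-allLists-suc (intRange n) k _)
  (trans (inv (λ y → Σ (allLists (intRange n) k) (λ w → F (y ∷ w)))) (sym (Σ-allLists-suc (intRange n) k F)))


Σ-intRange-neg : ∀ n (h : ℤ → ℕ) → Σ (intRange n) (λ x → h (ℤ.- x)) ≡ Σ (intRange n) h
Σ-intRange-neg n h = begin
    Σ (intRange n) (λ x → h (ℤ.- x))
  ≡⟨ Σ-++ (map (λ z → + z) (upTo (suc n))) (map -[1+_] (upTo n)) _ ⟩
    Σ (map (λ z → + z) (upTo (suc n))) (λ x → h (ℤ.- x)) + Σ (map -[1+_] (upTo n)) (λ x → h (ℤ.- x))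
  ≡⟨ cong₂ _+_ (trans (Σ-map (λ z → + z) (upTo (suc n)) _) (cong (_+_ (h (+ 0))) (Σ-applyUpTo suc (λ i → i) _ (λ k → h -[1+ k ]) (λ i → refl) n)))
               (trans (Σ-map -[1+_] (upTo n) _) refl) ⟩
    (h (+ 0) + B) + C
  ≡⟨ rearrange (h (+ 0)) B C ⟩
    (h (+ 0) + C) + B
  ≡⟨ sym (cong₂ _+_ (trans (Σ-map (λ z → + z) (upTo (suc n)) h) (cong (_+_ (h (+ 0))) (Σ-applyUpTo suc (λ i → i) _ (λ k → h (+ suc k)) (λ i → refl) n)))
               (Σ-map -[1+_] (upTo n) h)) ⟩
    Σ (map (λ z → + z) (upTo (suc n))) h + Σ (map -[1+_] (upTo n)) h
  ≡⟨ sym (Σ-++ (map (λ z → + z) (upTo (suc n))) (map -[1+_] (upTo n)) h) ⟩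
    Σ (intRange n) h ∎
  where
  open ≡-Reasoning
  B = Σ (upTo n) (λ k → h -[1+ k ])
  C = Σ (upTo n) (λ k → h (+ suc k))
  rearrange : ∀ a b c → (a + b) + c ≡ (a + c) + b
  rearrange = solve-∀

swap±1 : ℤ → ℤ
swap±1 (+ zero) = + zero
swap±1 (+ suc zero) = -[1+ zero ]
swap±1 (+ suc (suc k)) = + suc (suc k)
swap±1 -[1+ zero ] = + suc zero
swap±1 -[1+ suc k ] = -[1+ suc k ]

Σ-intRange-swap±1 : ∀ n (h : ℤ → ℕ) → Σ (intRange (suc n)) (λ x → h (swap±1 x)) ≡ Σ (intRange (suc n)) h
Σ-intRange-swap±1 n h = begin
    Σ (intRange (suc n)) (λ x → h (swap±1 x))
  ≡⟨ Σ-++ (map (λ z → + z) (upTo (suc (suc n)))) (map -[1+_] (upTo (suc n))) (λ x → h (swap±1 x)) ⟩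
    Σ (map (λ z → + z) (upTo (suc (suc n)))) (λ x → h (swap±1 x)) + Σ (map -[1+_] (upTo (suc n))) (λ x → h (swap±1 x))
  ≡⟨ cong₂ _+_ (trans (Σ-map (λ z → + z) (upTo (suc (suc n))) (λ x → h (swap±1 x))) (cong (λ z → h (+ 0) + (h -[1+ 0 ] + z)) (Σ-applyUpTo (λ i → suc (suc i)) (λ i → i) (λ k → h (swap±1 (+ k))) (λ k → h (+ suc (suc k))) (λ i → refl) n)))
               (trans (Σ-map -[1+_] (upTo (suc n)) (λ x → h (swap±1 x))) (cong (λ z → h (+ 1) + z) (Σ-applyUpTo suc (λ i → i) (λ k → h (swap±1 -[1+ k ])) (λ k → h -[1+ suc k ]) (λ i → refl) n))) ⟩
    (h (+ 0) + (h -[1+ 0 ] + A)) + (h (+ 1) + B)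
  ≡⟨ rearrange (h (+ 0)) (h -[1+ 0 ]) (h (+ 1)) A B ⟩
    (h (+ 0) + (h (+ 1) + A)) + (h -[1+ 0 ] + B)
  ≡⟨ sym (cong₂ _+_ (trans (Σ-map (λ z → + z) (upTo (suc (suc n))) h) (cong (λ z → h (+ 0) + (h (+ 1) + z)) (Σ-applyUpTo (λ i → suc (suc i)) (λ i → i) (λ k → h (+ k)) (λ k → h (+ suc (suc k))) (λ i → refl) n)))
               (trans (Σ-map -[1+_] (upTo (suc n)) h) (cong (λ z → h -[1+ 0 ] + z) (Σ-applyUpTo suc (λ i → i) (λ k → h -[1+ k ]) (λ k → h -[1+ suc k ]) (λ i → refl) n)))) ⟩
    Σ (map (λ z → + z) (upTo (suc (suc n)))) h + Σ (map -[1+_] (upTo (suc n))) h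
  ≡⟨ sym (Σ-++ (map (λ z → + z) (upTo (suc (suc n)))) (map -[1+_] (upTo (suc n))) h) ⟩
    Σ (intRange (suc n)) h ∎
  where
  open ≡-Reasoning
  A = Σ (upTo n) (λ k → h (+ suc (suc k)))
  B = Σ (upTo n) (λ k → h -[1+ suc k ])
  rearrange : ∀ a p q x y → (a + (p + x)) + (q + y) ≡ (a + (q + x)) + (p + y)
  rearrange = solve-∀


All-abs : ∀ {Q : ℕ → Set} (w w' : List ℤ) → map ∣_∣ w ≡ map ∣_∣ w' → All (λ x → Q ∣ x ∣) w → All (λ x → Q ∣ x ∣) w'
All-abs [] [] _ _ = []
All-abs {Q} (x ∷ w) (x' ∷ w') e (q ∷ qs) = subst Q (LP.∷-injectiveˡ e) q ∷ All-abs {Q} w w' (LP.∷-injectiveʳ e) qs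

AllPairs-abs : ∀ {R : ℕ → ℕ → Set} (w w' : List ℤ) → map ∣_∣ w ≡ map ∣_∣ w' → AllPairs (λ x y → R ∣ x ∣ ∣ y ∣) w → AllPairs (λ x y → R ∣ x ∣ ∣ y ∣) w'
AllPairs-abs [] [] _ _ = []
AllPairs-abs {R} (x ∷ w) (x' ∷ w') e (a ∷ ap) =
  subst (λ k → All (λ y → R k ∣ y ∣) w') (LP.∷-injectiveˡ e) (All-abs {λ k → R ∣ x ∣ k} w w' (LP.∷-injectiveʳ e) a)
  ∷ AllPairs-abs {R} w w' (LP.∷-injectiveʳ e) ap

isSignedPerm-abs : ∀ n (w w' : List ℤ) → map ∣_∣ w ≡ map ∣_∣ w' → IsSignedPerm n w → IsSignedPerm n w'
isSignedPerm-abs n w w' e (len , bnd , ap) =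
  trans (sym (LP.length-map ∣_∣ w')) (trans (cong length (sym e)) (trans (LP.length-map ∣_∣ w) len)) ,
  All-abs {λ k → 1 ℕ.≤ k × k ℕ.≤ n} w w' e bnd , AllPairs-abs {λ a b → a ≢ b} w w' e ap

abs-swap±1 : ∀ x → ∣ swap±1 x ∣ ≡ ∣ x ∣
abs-swap±1 (+ zero) = refl
abs-swap±1 (+ suc zero) = refl
abs-swap±1 (+ suc (suc k)) = refl
abs-swap±1 -[1+ zero ] = refl
abs-swap±1 -[1+ suc k ] = refl

map-abs-swap±1 : ∀ w → map ∣_∣ (map swap±1 w) ≡ map ∣_∣ w
map-abs-swap±1 [] = refl
map-abs-swap±1 (x ∷ w) = cong₂ _∷_ (abs-swap±1 x) (map-abs-swap±1 w)

map-abs-negateFirst : ∀ w → map ∣_∣ (negateFirst w) ≡ map ∣_∣ w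
map-abs-negateFirst [] = refl
map-abs-negateFirst (x ∷ w) = cong (_∷ map ∣_∣ w) (ℤP.∣-i∣≡∣i∣ x)

isSignedPerm-swap±1 : ∀ n w → ind (isSignedPerm? n (map swap±1 w)) ≡ ind (isSignedPerm? n w)
isSignedPerm-swap±1 n w = ind-⇔ _ _ (isSignedPerm-abs n (map swap±1 w) w (map-abs-swap±1 w)) (isSignedPerm-abs n w (map swap±1 w) (sym (map-abs-swap±1 w)))

isSignedPerm-negateFirst : ∀ n w → ind (isSignedPerm? n (negateFirst w)) ≡ ind (isSignedPerm? n w)
isSignedPerm-negateFirst n w = ind-⇔ _ _ (isSignedPerm-abs n (negateFirst w) w (map-abs-negateFirst w)) (isSignedPerm-abs n w (negateFirst w) (sym (map-abs-negateFirst w)))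

lessThanMinusOne : ℤ → ℕ
lessThanMinusOne (+ _) = 0
lessThanMinusOne -[1+ zero ] = 0
lessThanMinusOne -[1+ suc k ] = 1

isOne : ℤ → ℕ
isOne x = ind (∣ x ∣ ℕ.≟ 1)

swap±1-negatives : ∀ x → ind (swap±1 x ℤ.<? + 0) + ind (x ℤ.<? + 0) ≡ 2 * lessThanMinusOne x + isOne x
swap±1-negatives (+ zero) = refl
swap±1-negatives (+ suc zero) = refl
swap±1-negatives (+ suc (suc k)) = refl
swap±1-negatives -[1+ zero ] = refl
swap±1-negatives -[1+ suc k ] = refl

open Div using (divides; ∣m+n∣m⇒∣n; ∣1⇒≡1; ∣m∣n⇒∣m+n)

Even : ℕ → Set
Even a = Div._∣_ 2 a

even-or-odd : ∀ a → Even a ⊎ Even (suc a)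
even-or-odd zero = inj₁ (divides 0 refl)
even-or-odd (suc a) with even-or-odd a
... | inj₁ (divides q eq) = inj₂ (divides (suc q) (cong (λ z → suc (suc z)) eq))
... | inj₂ p = inj₁ p

not-both : ∀ x → Even x → Even (suc x) → ⊥
not-both x p q with ∣1⇒≡1 (∣m+n∣m⇒∣n (subst Even (ℕP.+-comm 1 x) q) p)
... | ()

two-div : ∀ E → Even (2 * E)
two-div E = divides E (ℕP.*-comm 2 E)

odd-sum-parity : ∀ a b E → a + b ≡ suc (2 * E) → ind (Div._∣?_ 2 a) + ind (Div._∣?_ 2 b) ≡ 1
odd-sum-parity a b E e with Div._∣?_ 2 a | Div._∣?_ 2 b
... | yes pa | yes pb = ⊥-elim (not-both (2 * E) (two-div E) (subst Even e (∣m∣n⇒∣m+n pa pb)))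
... | yes _ | no _ = refl
... | no _ | yes _ = refl
... | no na | no nb = ⊥-elim (not-both (2 * suc E) (two-div (suc E)) (subst Even eq (∣m∣n⇒∣m+n (odd a na) (odd b nb))))
  where
  odd : ∀ x → ¬ Even x → Even (suc x)
  odd x nx with even-or-odd x
  ... | inj₁ p = ⊥-elim (nx p)
  ... | inj₂ p = p
  rearrange : ∀ E → suc (suc (suc (2 * E))) ≡ suc (2 * suc E)
  rearrange = solve-∀
  eq : suc a + suc b ≡ suc (2 * suc E)
  eq = trans (cong suc (ℕP.+-suc a b)) (trans (cong (λ z → suc (suc z)) e) (rearrange E))


-- Counting signed permutations with descents in a given set

negCount-Σ : ∀ w → negCount w ≡ Σ w (λ x → ind (x ℤ.<? + 0))
negCount-Σ w = length-filter (λ x → x ℤ.<? + 0) w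

swap±1-parity : ∀ n w → 1 ≤ n → IsSignedPerm n w → ind (isEven? (map swap±1 w)) + ind (isEven? w) ≡ 1
swap±1-parity n w n1 sp = odd-sum-parity (negCount (map swap±1 w)) (negCount w) (Σ w lessThanMinusOne) eq
  where
  o-sum : Σ w isOne ≡ 1
  o-sum = trans (Σ-congᴬ w (proj₁ (proj₂ sp)) (λ x (p , _) → ind-⇔ (∣ x ∣ ℕ.≟ 1) (absIndex x ℕ.≟ 0) (λ e → cong (_∸ 1) e) (λ e → trans (sym (ℕP.m∸n+n≡m p)) (cong (_+ 1) e))))
                (countAbsIndex-signedPerm n w sp 0 n1)
  eq : negCount (map swap±1 w) + negCount w ≡ suc (2 * Σ w lessThanMinusOne)
  eq = begin
      negCount (map swap±1 w) + negCount w
    ≡⟨ cong₂ _+_ (trans (negCount-Σ (map swap±1 w)) (Σ-map swap±1 w _)) (negCount-Σ w) ⟩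
      Σ w (λ x → ind (swap±1 x ℤ.<? + 0)) + Σ w (λ x → ind (x ℤ.<? + 0))
    ≡⟨ sym (Σ-+ w _ _) ⟩
      Σ w (λ x → ind (swap±1 x ℤ.<? + 0) + ind (x ℤ.<? + 0))
    ≡⟨ Σ-ext w swap±1-negatives ⟩
      Σ w (λ x → 2 * lessThanMinusOne x + isOne x)
    ≡⟨ Σ-+ w _ _ ⟩
      Σ w (λ x → 2 * lessThanMinusOne x) + Σ w isOne
    ≡⟨ cong₂ _+_ (Σ-*ˡ w 2 lessThanMinusOne) o-sum ⟩
      2 * Σ w lessThanMinusOne + 1
    ≡⟨ ℕP.+-comm (2 * Σ w lessThanMinusOne) 1 ⟩
      suc (2 * Σ w lessThanMinusOne) ∎
    where open ≡-Reasoning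

swap±1-< : ∀ a b → 1 ≤ ∣ a ∣ → 1 ≤ ∣ b ∣ → ∣ a ∣ ≢ ∣ b ∣ → does (swap±1 a ℤ.<? swap±1 b) ≡ does (a ℤ.<? b)
swap±1-< (+ zero) b () _ _
swap±1-< a (+ zero) _ () _
swap±1-< (+ suc zero) (+ suc zero) _ _ d = ⊥-elim (d refl)
swap±1-< (+ suc zero) (+ suc (suc k)) _ _ _ = refl
swap±1-< (+ suc zero) -[1+ zero ] _ _ d = ⊥-elim (d refl)
swap±1-< (+ suc zero) -[1+ suc k ] _ _ _ = refl
swap±1-< (+ suc (suc j)) (+ suc zero) _ _ _ = refl
swap±1-< (+ suc (suc j)) (+ suc (suc k)) _ _ _ = refl
swap±1-< (+ suc (suc j)) -[1+ zero ] _ _ _ = refl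
swap±1-< (+ suc (suc j)) -[1+ suc k ] _ _ _ = refl
swap±1-< -[1+ zero ] (+ suc zero) _ _ d = ⊥-elim (d refl)
swap±1-< -[1+ zero ] (+ suc (suc k)) _ _ _ = refl
swap±1-< -[1+ zero ] -[1+ zero ] _ _ d = ⊥-elim (d refl)
swap±1-< -[1+ zero ] -[1+ suc k ] _ _ _ = refl
swap±1-< -[1+ suc j ] (+ suc zero) _ _ _ = refl
swap±1-< -[1+ suc j ] (+ suc (suc k)) _ _ _ = refl
swap±1-< -[1+ suc j ] -[1+ zero ] _ _ _ = refl
swap±1-< -[1+ suc j ] -[1+ suc k ] _ _ _ = refl

swap±1-neg : ∀ x → swap±1 (ℤ.- x) ≡ ℤ.- swap±1 x
swap±1-neg (+ zero) = refl
swap±1-neg (+ suc zero) = refl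
swap±1-neg (+ suc (suc k)) = refl
swap±1-neg -[1+ zero ] = refl
swap±1-neg -[1+ suc k ] = refl

entry-swap±1 : ∀ w i → entry (map swap±1 w) i ≡ swap±1 (entry w i)
entry-swap±1 [] i = refl
entry-swap±1 (x ∷ w) zero = refl
entry-swap±1 (x ∷ w) (suc i) = entry-swap±1 w i

val-swap±1 : ∀ w i → val (map swap±1 w) i ≡ swap±1 (val w i)
val-swap±1 w zero = trans (cong ℤ.-_ (entry-swap±1 w 1)) (sym (swap±1-neg (entry w 1)))
val-swap±1 w (suc i) = entry-swap±1 w i

applyUpTo-cong< : ∀ {A : Set} (f g : ℕ → A) n → (∀ i → i < n → f i ≡ g i) → applyUpTo f n ≡ applyUpTo g n
applyUpTo-cong< f g zero h = refl
applyUpTo-cong< f g (suc n) h = cong₂ _∷_ (h 0 (s≤s z≤n)) (applyUpTo-cong< (λ i → f (suc i)) (λ i → g (suc i)) n (λ i p → h (suc i) (s≤s p)))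

descentBits-swap±1 : ∀ n w → 2 ≤ n → IsSignedPerm n w → descentBits n (map swap±1 w) ≡ descentBits n w
descentBits-swap±1 n w n2 sp@(len , bnd , ap) = applyUpTo-cong< _ _ n pt
  where
  ab : ∀ i → i < n → 1 ≤ ∣ entry w i ∣
  ab i p = proj₁ (All-entry bnd i (subst (i <_) (sym len) p))
  dist : ∀ i j → i < n → j < n → i ≢ j → ∣ entry w i ∣ ≢ ∣ entry w j ∣
  dist i j pi pj ne e = ne (absDistinct-position-unique w ap i j (subst (i <_) (sym len) pi) (subst (j <_) (sym len) pj) e)
  pt : ∀ i → i < n → does (isDescent? (map swap±1 w) i) ≡ does (isDescent? w i)
  pt zero p = trans (cong₂ (λ a b → does (a ℤ.<? b)) (val-swap±1 w 1) (val-swap±1 w 0))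
    (swap±1-< (entry w 0) (ℤ.- entry w 1) (ab 0 p) (subst (1 ≤_) (sym (ℤP.∣-i∣≡∣i∣ (entry w 1))) (ab 1 n2))
       (λ e → dist 0 1 p n2 (λ ()) (trans e (ℤP.∣-i∣≡∣i∣ (entry w 1)))))
  pt (suc i) p = trans (cong₂ (λ a b → does (a ℤ.<? b)) (val-swap±1 w (suc (suc i))) (val-swap±1 w (suc i)))
    (swap±1-< (entry w (suc i)) (entry w i) (ab (suc i) p) (ab i (ℕP.<-trans (ℕP.n<1+n i) p))
       (dist (suc i) i p (ℕP.<-trans (ℕP.n<1+n i) p) (λ e → ℕP.1+n≢n e)))


belowCount : ℕ → List Bool → ℕ
belowCount n S = Σ (allLists (intRange n) n) (λ w → ind (isSignedPerm? n w) * boolToℕ (subsetᵇ (descentBits n w) S))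

evenBelowCount : ℕ → List Bool → ℕ
evenBelowCount n S = Σ (allLists (intRange n) n) (λ w → ind (isEvenSignedPerm? n w) * boolToℕ (subsetᵇ (descentBits n w) S))

-- Swapping the signs of the entries ±1 changes the parity of a signed permutation but, for n ≥ 2,
-- not its descent set; so exactly half of the permutations counted by belowCount are even.
double-evenCount : ∀ n' (S : List Bool) →
  2 * evenBelowCount (suc (suc n')) S ≡ belowCount (suc (suc n')) S
double-evenCount n' S = begin
    2 * Σ W (λ w → ind (isEvenSignedPerm? n w) * C w)
  ≡⟨ cong (2 *_) (Σ-ext W (λ w → cong (_* C w) (ind-× (isSignedPerm? n w) (isEven? w)))) ⟩
    2 * Σ W F
  ≡⟨ rearrange (Σ W F) ⟩
    Σ W F + Σ W F
  ≡⟨ cong (_+ Σ W F) (sym (Σ-allLists-map (intRange n) swap±1 (Σ-intRange-swap±1 (suc n')) n F)) ⟩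
    Σ W (λ w → F (map swap±1 w)) + Σ W F
  ≡⟨ sym (Σ-+ W _ F) ⟩
    Σ W (λ w → F (map swap±1 w) + F w)
  ≡⟨ Σ-ext W (λ w → pointwise w (isSignedPerm? n w)) ⟩
    Σ W (λ w → ind (isSignedPerm? n w) * C w) ∎
  where
  open ≡-Reasoning
  n = suc (suc n')
  W = allLists (intRange n) n
  C : List ℤ → ℕ
  C w = boolToℕ (subsetᵇ (descentBits n w) S)
  F : List ℤ → ℕ
  F w = ind (isSignedPerm? n w) * ind (isEven? w) * C w
  rearrange : ∀ x → 2 * x ≡ x + x
  rearrange = solve-∀
  pointwise : ∀ w → (d : Dec (IsSignedPerm n w)) → F (map swap±1 w) + F w ≡ ind (isSignedPerm? n w) * C w
  pointwise w (yes s) = begin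
      ind (isSignedPerm? n (map swap±1 w)) * ind (isEven? (map swap±1 w)) * C (map swap±1 w) + ind (isSignedPerm? n w) * ind (isEven? w) * C w
    ≡⟨ cong₂ (λ a c → a * ind (isEven? (map swap±1 w)) * c + ind (isSignedPerm? n w) * ind (isEven? w) * C w)
         (trans (isSignedPerm-swap±1 n w) sp1) (cong (λ z → boolToℕ (subsetᵇ z S)) (descentBits-swap±1 n w (s≤s (s≤s z≤n)) s)) ⟩
      1 * ind (isEven? (map swap±1 w)) * C w + ind (isSignedPerm? n w) * ind (isEven? w) * C w
    ≡⟨ cong (λ a → 1 * ind (isEven? (map swap±1 w)) * C w + a * ind (isEven? w) * C w) sp1 ⟩
      1 * ind (isEven? (map swap±1 w)) * C w + 1 * ind (isEven? w) * C w
    ≡⟨ distrib (ind (isEven? (map swap±1 w))) (ind (isEven? w)) (C w) ⟩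
      (ind (isEven? (map swap±1 w)) + ind (isEven? w)) * C w
    ≡⟨ cong (_* C w) (swap±1-parity n w (s≤s z≤n) s) ⟩
      1 * C w
    ≡⟨ cong (_* C w) (sym sp1) ⟩
      ind (isSignedPerm? n w) * C w ∎
    where
    sp1 : ind (isSignedPerm? n w) ≡ 1
    sp1 = ind-yes (isSignedPerm? n w) s
    distrib : ∀ a b c → 1 * a * c + 1 * b * c ≡ (a + b) * c
    distrib = solve-∀
  pointwise w (no ¬s) rewrite isSignedPerm-swap±1 n w | ind-no (isSignedPerm? n w) ¬s = refl


tailDescents : List ℤ → List Bool
tailDescents (x ∷ y ∷ w) = does (y ℤ.<? x) ∷ tailDescents (y ∷ w)
tailDescents _ = []

tailDescents-applyUpTo : ∀ x w' → applyUpTo (λ i → does (isDescent? (x ∷ w') (suc i))) (length w') ≡ tailDescents (x ∷ w')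
tailDescents-applyUpTo x [] = refl
tailDescents-applyUpTo x (y ∷ w'') = cong (does (y ℤ.<? x) ∷_) (tailDescents-applyUpTo y w'')

not-<-leqᵇ : ∀ x y → not (does (y ℤ.<? x)) ≡ leqᵇ x y
not-<-leqᵇ x y with y ℤ.<? x | x ℤ.≤? y
... | yes p | yes q = ⊥-elim (ℤP.<⇒≱ p q)
... | yes p | no _ = refl
... | no _ | yes _ = refl
... | no ¬p | no ¬q = ⊥-elim (¬q (ℤP.≮⇒≥ ¬p))

subsetᵇ-blockwise : ∀ rest b' x w' → All (1 ≤_) rest → length w' ≡ b' + sum rest →
  subsetᵇ (tailDescents (x ∷ w')) (replicate b' false ++ tailWord rest) ≡ ascendingFrom x (take b' w') ∧ blockwiseAscending rest (drop b' w')
subsetᵇ-blockwise [] zero x [] _ _ = refl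
subsetᵇ-blockwise [] zero x (y ∷ w'') _ ()
subsetᵇ-blockwise (zero ∷ rest') zero x w' (() ∷ _) e
subsetᵇ-blockwise (suc r' ∷ rest') zero x [] _ ()
subsetᵇ-blockwise (suc r' ∷ rest') zero x (y ∷ w'') (_ ∷ ps) e =
  trans (cong (_∧ subsetᵇ (tailDescents (y ∷ w'')) (replicate r' false ++ tailWord rest')) (∨-zeroʳ (not (does (y ℤ.<? x)))))
        (subsetᵇ-blockwise rest' r' y w'' ps (ℕP.suc-injective e))
subsetᵇ-blockwise rest (suc b'') x [] ps ()
subsetᵇ-blockwise rest (suc b'') x (y ∷ w'') ps e =
  trans (cong₂ _∧_ (trans (∨-identityʳ _) (not-<-leqᵇ x y)) (subsetᵇ-blockwise rest b'' y w'' ps (ℕP.suc-injective e)))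
        (sym (∧-assoc (leqᵇ x y) (ascendingFrom y (take b'' w'')) (blockwiseAscending rest (drop b'' w''))))

descentBits-∷ : ∀ x w' → descentBits (suc (length w')) (x ∷ w') ≡ does (isDescent? (x ∷ w') 0) ∷ tailDescents (x ∷ w')
descentBits-∷ x w' = cong (does (isDescent? (x ∷ w') 0) ∷_) (tailDescents-applyUpTo x w')

subsetᵇ-head0 : ∀ r' rest' x w' → All (1 ≤_) rest' → length w' ≡ r' + sum rest' →
  subsetᵇ (descentBits (suc (length w')) (x ∷ w')) (descentWord (0 ∷ suc r' ∷ rest')) ≡ blockwiseAscending (suc r' ∷ rest') (x ∷ w')
subsetᵇ-head0 r' rest' x w' ps e = trans (cong (λ z → subsetᵇ z (descentWord (0 ∷ suc r' ∷ rest'))) (descentBits-∷ x w'))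
  (trans (cong (_∧ subsetᵇ (tailDescents (x ∷ w')) (replicate r' false ++ tailWord rest')) (∨-zeroʳ _)) (subsetᵇ-blockwise rest' r' x w' ps e))

subsetᵇ-headSuc : ∀ a' rest x w' → All (1 ≤_) rest → length w' ≡ a' + sum rest →
  subsetᵇ (descentBits (suc (length w')) (x ∷ w')) (descentWord (suc a' ∷ rest)) ≡ not (does (isDescent? (x ∷ w') 0)) ∧ blockwiseAscending (suc a' ∷ rest) (x ∷ w')
subsetᵇ-headSuc a' rest x w' ps e = trans (cong (λ z → subsetᵇ z (descentWord (suc a' ∷ rest))) (descentBits-∷ x w'))
  (cong₂ _∧_ (∨-identityʳ _) (subsetᵇ-blockwise rest a' x w' ps e))

-- For β₁ = 0 only the blocks of w(1),…,w(n) matter; a leading singleton block [0] leaves all signs free.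
belowCount-head0 : ∀ k r' rest' → All (1 ≤_) rest' → suc r' + sum rest' ≡ suc k →
  belowCount (suc k) (descentWord (0 ∷ suc r' ∷ rest')) ≡ ascendingCount (suc k) (1 ∷ 0 ∷ suc r' ∷ rest')
belowCount-head0 k r' rest' ps e = Σ-allLists-cong (intRange (suc k)) (suc k) pointwise
  where
  pointwise : ∀ w → length w ≡ suc k → ind (isSignedPerm? (suc k) w) * boolToℕ (subsetᵇ (descentBits (suc k) w) (descentWord (0 ∷ suc r' ∷ rest')))
                                 ≡ ind (isSignedPerm? (suc k) w) * boolToℕ (blockwiseAscending (1 ∷ 0 ∷ suc r' ∷ rest') (+ 0 ∷ w))
  pointwise (x ∷ w') l = cong (λ z → ind (isSignedPerm? (suc k) (x ∷ w')) * boolToℕ z)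
    (trans (cong (λ m → subsetᵇ (descentBits m (x ∷ w')) (descentWord (0 ∷ suc r' ∷ rest'))) (sym l))
           (subsetᵇ-head0 r' rest' x w' ps (trans (ℕP.suc-injective l) (sym (ℕP.suc-injective e)))))

-- No descent at 0 and at 1 means -w(2) ≤ w(1) ≤ w(2), i.e. 0 ≤ |w(1)| ≤ w(2): split by the sign of w(1).
boolToℕ-splitSign : ∀ x y t r → 1 ≤ ∣ x ∣ →
  boolToℕ (not (does (x ℤ.<? ℤ.- y)) ∧ ((leqᵇ x y ∧ t) ∧ r)) ≡ boolToℕ ((leqᵇ (+ 0) x ∧ (leqᵇ x y ∧ t)) ∧ r) + boolToℕ ((leqᵇ (+ 0) (ℤ.- x) ∧ (leqᵇ (ℤ.- x) y ∧ t)) ∧ r)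
boolToℕ-splitSign (+ zero) y t r ()
boolToℕ-splitSign (+ suc k) y t r _ = trans (cong boolToℕ (trans (sym (∧-assoc A' (leqᵇ (+ suc k) y ∧ t) r)) (cong (_∧ r) (by-bound (leqᵇ (+ suc k) y) refl)))) (sym (ℕP.+-identityʳ _))
  where
  A' = not (does (+ suc k ℤ.<? ℤ.- y))
  by-bound : ∀ b → leqᵇ (+ suc k) y ≡ b → not (does (+ suc k ℤ.<? ℤ.- y)) ∧ (b ∧ t) ≡ b ∧ t
  by-bound false _ = ∧-zeroʳ _
  by-bound true eq with + suc k ℤ.<? ℤ.- y
  ... | no _ = refl
  ... | yes p = ⊥-elim (bad (ℤP.<-≤-trans p (ℤP.neg-mono-≤ (does-true⁻ (+ suc k ℤ.≤? y) eq))))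
    where
    bad : + suc k ℤ.< -[1+ k ] → ⊥
    bad ()
boolToℕ-splitSign -[1+ k ] y t r _ = cong boolToℕ (trans (sym (∧-assoc A (leqᵇ -[1+ k ] y ∧ t) r)) (cong (_∧ r) (trans (sym (∧-assoc A (leqᵇ -[1+ k ] y) t)) (cong (_∧ t) negative-case))))
  where
  A = not (does (-[1+ k ] ℤ.<? ℤ.- y))
  negative-case : A ∧ leqᵇ -[1+ k ] y ≡ leqᵇ (+ suc k) y
  negative-case with -[1+ k ] ℤ.<? ℤ.- y | -[1+ k ] ℤ.≤? y | + suc k ℤ.≤? y
  ... | yes p | _ | no _ = refl
  ... | yes p | _ | yes q = ⊥-elim (ℤP.<⇒≱ p (subst (ℤ._≤ -[1+ k ]) refl (ℤP.neg-mono-≤ q)))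
  ... | no _ | no _ | no _ = refl
  ... | no _ | no ¬b | yes q = ⊥-elim (¬b (ℤP.≤-trans ℤ.-≤+ q))
  ... | no ¬p | yes _ | yes _ = refl
  ... | no ¬p | yes b | no ¬q = ⊥-elim (¬q (subst (+ suc k ℤ.≤_) (ℤP.neg-involutive y) (ℤP.neg-mono-≤ (ℤP.≮⇒≥ ¬p))))

belowCount-head≥2 : ∀ k a rest → All (1 ≤_) rest → suc (suc a) + sum rest ≡ suc k →
  belowCount (suc k) (descentWord (suc (suc a) ∷ rest)) ≡ ascendingCount (suc k) (suc (suc (suc a)) ∷ rest) + ascendingCount (suc k) (suc (suc (suc a)) ∷ rest)
belowCount-head≥2 k a rest ps e = begin
    belowCount (suc k) S
  ≡⟨ Σ-allLists-cong (intRange (suc k)) (suc k) (λ w l → pointwise w l (isSignedPerm? (suc k) w)) ⟩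
    Σ W (λ w → G w + G (negateFirst w))
  ≡⟨ Σ-+ W G (λ w → G (negateFirst w)) ⟩
    Σ W G + Σ W (λ w → G (negateFirst w))
  ≡⟨ cong (_+_ (Σ W G)) (Σ-allLists-negateFirst (suc k) k G (Σ-intRange-neg (suc k))) ⟩
    Σ W G + Σ W G ∎
  where
  open ≡-Reasoning
  S = descentWord (suc (suc a) ∷ rest)
  γ = suc (suc (suc a)) ∷ rest
  W = allLists (intRange (suc k)) (suc k)
  G : List ℤ → ℕ
  G w = ind (isSignedPerm? (suc k) w) * boolToℕ (blockwiseAscending γ (+ 0 ∷ w))
  pointwise : ∀ w → length w ≡ suc k → (d : Dec (IsSignedPerm (suc k) w)) →
       ind (isSignedPerm? (suc k) w) * boolToℕ (subsetᵇ (descentBits (suc k) w) S) ≡ G w + G (negateFirst w)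
  pointwise (x ∷ []) l d = ⊥-elim (ℕP.<-irrefl refl (ℕP.≤-trans (s≤s (s≤s z≤n)) (ℕP.≤-trans (ℕP.m≤m+n (suc (suc a)) (sum rest)) (ℕP.≤-reflexive (trans e (sym l))))))
  pointwise (x ∷ y ∷ w'') l (no ¬s) rewrite ind-no (isSignedPerm? (suc k) (x ∷ y ∷ w'')) ¬s | isSignedPerm-negateFirst (suc k) (x ∷ y ∷ w'') | ind-no (isSignedPerm? (suc k) (x ∷ y ∷ w'')) ¬s = refl
  pointwise (x ∷ y ∷ w'') l (yes s) rewrite isSignedPerm-negateFirst (suc k) (x ∷ y ∷ w'') | ind-yes (isSignedPerm? (suc k) (x ∷ y ∷ w'')) s =
    trans (cong (λ z → boolToℕ z + 0) (trans (cong (λ m → subsetᵇ (descentBits m (x ∷ y ∷ w'')) S) (sym l))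
            (subsetᵇ-headSuc (suc a) rest x (y ∷ w'') ps (trans (ℕP.suc-injective l) (sym (ℕP.suc-injective e))))))
    (trans (ℕP.+-identityʳ _) (trans (boolToℕ-splitSign x y (ascendingFrom y (take a w'')) (blockwiseAscending rest (drop a w'')) (proj₁ (All-entry (proj₁ (proj₂ s)) 0 (subst (0 <_) (sym (proj₁ s)) (s≤s z≤n)))))
      (sym (cong₂ _+_ (ℕP.*-identityˡ (boolToℕ (blockwiseAscending γ (+ 0 ∷ x ∷ y ∷ w'')))) (ℕP.*-identityˡ (boolToℕ (blockwiseAscending γ (+ 0 ∷ ℤ.- x ∷ y ∷ w''))))))))

subsetᵇ-head1-swap : ∀ a a' b b' L → a ≡ b' → (not a ∨ false) ∧ ((not b ∨ true) ∧ L) ≡ (not a' ∨ true) ∧ ((not b' ∨ false) ∧ L)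
subsetᵇ-head1-swap a a' b .a L refl = trans (cong₂ _∧_ (∨-identityʳ (not a)) (cong (_∧ L) (∨-zeroʳ (not b))))
                         (sym (trans (cong₂ _∧_ (∨-zeroʳ (not a')) (cong (_∧ L) (∨-identityʳ (not a)))) refl))

neg-< : ∀ x y → does (ℤ.- x ℤ.<? ℤ.- y) ≡ does (y ℤ.<? x)
neg-< x y with ℤ.- x ℤ.<? ℤ.- y | y ℤ.<? x
... | yes _ | yes _ = refl
... | no _ | no _ = refl
... | yes p | no ¬q = ⊥-elim (¬q (subst₂ ℤ._<_ (ℤP.neg-involutive y) (ℤP.neg-involutive x) (ℤP.neg-mono-< p)))
... | no ¬p | yes q = ⊥-elim (¬p (ℤP.neg-mono-< q))

-- Negating w(1) exchanges the descent conditions at positions 0 and 1.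
belowCount-head1 : ∀ k' r' rest' →
  belowCount (suc (suc k')) (descentWord (1 ∷ suc r' ∷ rest')) ≡ belowCount (suc (suc k')) (descentWord (0 ∷ suc (suc r') ∷ rest'))
belowCount-head1 k' r' rest' = trans (sym (Σ-allLists-negateFirst n (suc k') F (Σ-intRange-neg n)))
  (Σ-allLists-cong (intRange n) n pointwise)
  where
  n = suc (suc k')
  W = allLists (intRange n) n
  F : List ℤ → ℕ
  F w = ind (isSignedPerm? n w) * boolToℕ (subsetᵇ (descentBits n w) (descentWord (1 ∷ suc r' ∷ rest')))
  pointwise : ∀ w → length w ≡ n → F (negateFirst w) ≡ ind (isSignedPerm? n w) * boolToℕ (subsetᵇ (descentBits n w) (descentWord (0 ∷ suc (suc r') ∷ rest')))
  pointwise (x ∷ y ∷ w'') l = cong₂ (λ a b → a * boolToℕ b) (isSignedPerm-negateFirst n (x ∷ y ∷ w''))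
    (subsetᵇ-head1-swap (does (ℤ.- x ℤ.<? ℤ.- y)) (does (x ℤ.<? ℤ.- y)) (does (y ℤ.<? ℤ.- x)) (does (y ℤ.<? x))
       (subsetᵇ (applyUpTo (λ i → does (isDescent? (x ∷ y ∷ w'') (suc (suc i)))) k') (replicate r' false ++ tailWord rest'))
       (neg-< x y))

module _ (n' : ℕ) where
  private
    n = suc (suc n')

  belowCount≡2*nu : ∀ β → IsPseudoComposition n β → belowCount n (descentWord β) ≡ 2 * nu n β
  belowCount≡2*nu [] (() , _)
  belowCount≡2*nu (0 ∷ []) (_ , _ , ())
  belowCount≡2*nu (0 ∷ zero ∷ _) (_ , () ∷ _ , _)
  belowCount≡2*nu (0 ∷ suc r' ∷ rest') (_ , _ ∷ ps , e) = begin
      belowCount n (descentWord (0 ∷ suc r' ∷ rest'))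
    ≡⟨ belowCount-head0 (suc n') r' rest' ps e ⟩
      ascendingCount n (1 ∷ 0 ∷ suc r' ∷ rest')
    ≡⟨ ascendingCount≡formula n (1 ∷ 0 ∷ suc r' ∷ rest') (cong suc e) (s≤s z≤n) ⟩
      2 ^ (suc r' + sum rest') * (1 * multi (0 ∷ suc r' ∷ rest'))
    ≡⟨ cong₂ (λ z x → 2 ^ z * x) e (ℕP.*-identityˡ _) ⟩
      2 ^ n * multi (0 ∷ suc r' ∷ rest')
    ≡⟨ ℕP.*-assoc 2 (2 ^ suc n') _ ⟩
      2 * (2 ^ suc n' * multi (0 ∷ suc r' ∷ rest'))
    ≡⟨ cong (λ z → 2 * (2 ^ suc n' * z)) (sym (multinomial≡multi n (0 ∷ suc r' ∷ rest') e)) ⟩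
      2 * nu n (0 ∷ suc r' ∷ rest') ∎
    where open ≡-Reasoning
  belowCount≡2*nu (1 ∷ []) (_ , _ , ())
  belowCount≡2*nu (1 ∷ zero ∷ _) (_ , () ∷ _ , _)
  belowCount≡2*nu (1 ∷ suc r' ∷ rest') (_ , _ ∷ ps , e) = begin
      belowCount n (descentWord (1 ∷ suc r' ∷ rest'))
    ≡⟨ belowCount-head1 n' r' rest' ⟩
      belowCount n (descentWord (0 ∷ suc (suc r') ∷ rest'))
    ≡⟨ belowCount-head0 (suc n') (suc r') rest' ps e ⟩
      ascendingCount n (1 ∷ 0 ∷ suc (suc r') ∷ rest')
    ≡⟨ ascendingCount≡formula n (1 ∷ 0 ∷ suc (suc r') ∷ rest') (cong suc e) (s≤s z≤n) ⟩
      2 ^ (suc (suc r') + sum rest') * (1 * (1 * multi (suc (suc r') ∷ rest')))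
    ≡⟨ cong₂ (λ z x → 2 ^ z * x) e (trans (ℕP.*-identityˡ _) (ℕP.*-identityˡ _)) ⟩
      2 ^ n * multi (suc (suc r') ∷ rest')
    ≡⟨ ℕP.*-assoc 2 (2 ^ suc n') _ ⟩
      2 * (2 ^ suc n' * multi (suc (suc r') ∷ rest'))
    ≡⟨ cong (λ z → 2 * (2 ^ suc n' * z)) (sym (multinomial≡multi n (suc (suc r') ∷ rest') e)) ⟩
      2 * nu n (1 ∷ suc r' ∷ rest') ∎
    where open ≡-Reasoning
  belowCount≡2*nu (suc (suc a) ∷ rest) (_ , ps , e) = begin
      belowCount n (descentWord (suc (suc a) ∷ rest))
    ≡⟨ belowCount-head≥2 (suc n') a rest ps e ⟩
      ascendingCount n γ + ascendingCount n γ
    ≡⟨ cong (λ z → z + z) (ascendingCount≡formula n γ (cong suc e) (s≤s z≤n)) ⟩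
      ascendingFormula γ + ascendingFormula γ
    ≡⟨ cong (_+_ (ascendingFormula γ)) (sym (ℕP.+-identityʳ _)) ⟩
      2 * (2 ^ sum rest * multi (suc (suc a) ∷ rest))
    ≡⟨ cong₂ (λ x y → 2 * (2 ^ x * y)) (sym (trans (cong (_∸ suc (suc a)) (sym e)) (ℕP.m+n∸m≡n (suc (suc a)) (sum rest))))
                                       (sym (multinomial≡multi n (suc (suc a) ∷ rest) e)) ⟩
      2 * nu n (suc (suc a) ∷ rest) ∎
    where
    open ≡-Reasoning
    γ = suc (suc (suc a)) ∷ rest

nu≡evenBelowCount : ∀ n → 2 ≤ n → ∀ β → IsPseudoComposition n β → nu n β ≡ evenBelowCount n (descentWord β)
nu≡evenBelowCount (suc (suc n')) (s≤s (s≤s _)) β pc =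
  ℕP.*-cancelˡ-≡ _ _ 2 (sym (trans (double-evenCount n' (descentWord β)) (belowCount≡2*nu n' β pc)))


-- The alternating sum

DesSet⊆⇔subsetᵇ : ∀ n β α → IsPseudoComposition n β → IsPseudoComposition n α →
  (All (λ d → d ∈ DesSet α) (DesSet β) → subsetᵇ (descentWord β) (descentWord α) ≡ true) ×
  (subsetᵇ (descentWord β) (descentWord α) ≡ true → All (λ d → d ∈ DesSet α) (DesSet β))
DesSet⊆⇔subsetᵇ n [] α (() , _) pα
DesSet⊆⇔subsetᵇ n β [] pβ (() , _)
DesSet⊆⇔subsetᵇ n (b ∷ bs) (a ∷ as) pβ pα =
  (λ al → subsetᵇ-complete (descentWord (b ∷ bs)) (descentWord (a ∷ as)) (trans (length-descentWord b bs n pβ) (sym (length-descentWord a as n pα)))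
            (λ i q → proj₁ (DesSet⇔bitAt a as n pα i) (All.lookup al (proj₂ (DesSet⇔bitAt b bs n pβ i) q)))) ,
  (λ sub → All.tabulate (λ {d} m → proj₂ (DesSet⇔bitAt a as n pα d)
            (subsetᵇ-sound (descentWord (b ∷ bs)) (descentWord (a ∷ as)) sub d (proj₁ (DesSet⇔bitAt b bs n pβ d) m))))

bool-⇔ : ∀ (x y : Bool) → (x ≡ true → y ≡ true) → (y ≡ true → x ≡ true) → x ≡ y
bool-⇔ true  true  _ _ = refl
bool-⇔ true  false f _ = sym (f refl)
bool-⇔ false true  _ g = g refl
bool-⇔ false false _ _ = refl

DesEq⇔descentBits≡ : ∀ n w a as → IsPseudoComposition n (a ∷ as) →
  (DesEq n w (a ∷ as) → descentBits n w ≡ descentWord (a ∷ as)) × (descentBits n w ≡ descentWord (a ∷ as) → DesEq n w (a ∷ as))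
DesEq⇔descentBits≡ n w a as pα = to , from
  where
  A = descentWord (a ∷ as)
  lenA : length A ≡ n
  lenA = length-descentWord a as n pα
  to : DesEq n w (a ∷ as) → descentBits n w ≡ A
  to de = bitAt-extensionality (descentBits n w) A (trans (LP.length-applyUpTo _ n) (sym lenA)) pt
    where
    pt : ∀ i → bitAt (descentBits n w) i ≡ bitAt A i
    pt i with i ℕ.<? n
    ... | yes i<n = trans (bitAt-applyUpTo _ n i i<n)
          (bool-⇔ _ _ (λ d → proj₁ (DesSet⇔bitAt a as n pα i) (proj₁ (All.lookup de (∈-upTo⁺ i<n)) (does-true⁻ (isDescent? w i) d)))
                      (λ q → dec-true (isDescent? w i) (proj₂ (All.lookup de (∈-upTo⁺ i<n)) (proj₂ (DesSet⇔bitAt a as n pα i) q))))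
    ... | no ¬i<n = trans (bitAt-≥length (descentBits n w) i (subst (_≤ i) (sym (LP.length-applyUpTo _ n)) (ℕP.≮⇒≥ ¬i<n)))
                          (sym (bitAt-≥length A i (subst (_≤ i) (sym lenA) (ℕP.≮⇒≥ ¬i<n))))
  from : descentBits n w ≡ A → DesEq n w (a ∷ as)
  from e = All.tabulate (λ {i} m → let i<n = ∈-upTo⁻ m
                                       bd = bitAt-applyUpTo (λ j → does (isDescent? w j)) n i i<n
                                       ee = cong (λ x → bitAt x i) e in
      (λ d → proj₂ (DesSet⇔bitAt a as n pα i) (trans (sym ee) (trans bd (dec-true (isDescent? w i) d)))) ,
      (λ q → does-true⁻ (isDescent? w i) (trans (sym bd) (trans ee (proj₁ (DesSet⇔bitAt a as n pα i) q)))))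

module _ (n a : ℕ) (as : List ℕ) (pα : IsPseudoComposition n (a ∷ as)) where

  signedWords : List (List ℤ)
  signedWords = allLists (intRange n) n

  isBelow? : ∀ β → Dec (All (λ d → d ∈ DesSet (a ∷ as)) (DesSet β))
  isBelow? β = All.all? (λ d → d ∈? DesSet (a ∷ as)) (DesSet β)

  rhsTerm : List ℕ → ℤ
  rhsTerm β = (ℤ.-1ℤ ℤ.^ (length (a ∷ as) ∸ length β)) ℤ.* + nu n β

  möbiusSummand : List Bool → List ℤ → ℤ
  möbiusSummand bs w = + ind (isEvenSignedPerm? n w) ℤ.* möbiusTerm (descentBits n w) (descentWord (a ∷ as)) bs

  rD≡Σ-descentBits : + rD n (a ∷ as) ≡ + Σ signedWords (λ w → ind (isEvenSignedPerm? n w) * ind (descentBits n w ≟𝔹* descentWord (a ∷ as)))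
  rD≡Σ-descentBits = cong +_ (trans (length-filter P? signedWords) (Σ-ext signedWords (λ w → sym (factor w))))
    where
    open ≡-Reasoning
    P? = λ w → isSignedPerm? n w ×-dec isEven? w ×-dec desEq? n w (a ∷ as)
    factor : ∀ w → ind (isEvenSignedPerm? n w) * ind (descentBits n w ≟𝔹* descentWord (a ∷ as)) ≡ ind (P? w)
    factor w = begin
        ind (isEvenSignedPerm? n w) * ind (descentBits n w ≟𝔹* descentWord (a ∷ as))
      ≡⟨ cong₂ _*_ (ind-× (isSignedPerm? n w) (isEven? w))
                   (ind-⇔ (descentBits n w ≟𝔹* descentWord (a ∷ as)) (desEq? n w (a ∷ as))
                          (proj₂ (DesEq⇔descentBits≡ n w a as pα)) (proj₁ (DesEq⇔descentBits≡ n w a as pα))) ⟩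
        ind (isSignedPerm? n w) * ind (isEven? w) * ind (desEq? n w (a ∷ as))
      ≡⟨ ℕP.*-assoc (ind (isSignedPerm? n w)) _ _ ⟩
        ind (isSignedPerm? n w) * (ind (isEven? w) * ind (desEq? n w (a ∷ as)))
      ≡⟨ cong (ind (isSignedPerm? n w) *_) (sym (ind-× (isEven? w) (desEq? n w (a ∷ as)))) ⟩
        ind (isSignedPerm? n w) * ind (isEven? w ×-dec desEq? n w (a ∷ as))
      ≡⟨ sym (ind-× (isSignedPerm? n w) _) ⟩
        ind (P? w) ∎

  rhs≡Σ-words : rhs n (a ∷ as) ≡ Σℤ (allLists bools n) (λ bs → ifℤ (isBelow? (fromDescentWord bs)) (rhsTerm (fromDescentWord bs)))
  rhs≡Σ-words = begin
      rhs n (a ∷ as)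
    ≡⟨ Σℤ-filter (λ β → isPseudoComposition? n β ×-dec isBelow? β) (candidates n) rhsTerm ⟩
      Σℤ (candidates n) (λ β → ifℤ (isPseudoComposition? n β ×-dec isBelow? β) (rhsTerm β))
    ≡⟨ Σℤ-ext (candidates n) (λ β → ifℤ-× (isPseudoComposition? n β) (isBelow? β) (rhsTerm β)) ⟩
      Σℤ (candidates n) (λ β → ifℤ (isPseudoComposition? n β) (ifℤ (isBelow? β) (rhsTerm β)))
    ≡⟨ Σ-pseudoCompositions n (λ β → ifℤ (isBelow? β) (rhsTerm β)) ⟩
      Σℤ (allLists bools n) (λ bs → ifℤ (isBelow? (fromDescentWord bs)) (rhsTerm (fromDescentWord bs))) ∎
    where open ≡-Reasoning

  -- ν(β) counts the even signed permutations w with D(w) ⊆ D(β), so each term of the right-hand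
  -- side is a sum of Möbius terms.
  rhsTerm≡Σ-möbiusSummand : 2 ≤ n → ∀ bs → length bs ≡ n →
    ifℤ (isBelow? (fromDescentWord bs)) (rhsTerm (fromDescentWord bs)) ≡ Σℤ signedWords (λ w → möbiusSummand bs w)
  rhsTerm≡Σ-möbiusSummand 2≤n bs e = begin
      ifℤ (isBelow? β) (rhsTerm β)
    ≡⟨ cong (ifℤ (isBelow? β)) (cong₂ (λ x y → (ℤ.-1ℤ ℤ.^ x) ℤ.* + y) (cong₂ _∸_ length-α (length-runs 0 bs)) evenCount) ⟩
      ifℤ (isBelow? β) (sign ℤ.* + Σ signedWords g)
    ≡⟨ by-subset (subsetᵇ bs αWord) refl ⟩
      Σℤ signedWords (λ w → möbiusSummand bs w) ∎
    where
    open ≡-Reasoning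
    β = fromDescentWord bs
    pβ = fromDescentWord-isPseudoComposition n bs e
    αWord = descentWord (a ∷ as)
    sign = ℤ.-1ℤ ℤ.^ (countTrue αWord ∸ countTrue bs)
    g = λ w → ind (isEvenSignedPerm? n w) * boolToℕ (subsetᵇ (descentBits n w) bs)
    length-α : length (a ∷ as) ≡ suc (countTrue αWord)
    length-α = trans (cong length (sym (fromDescentWord-descentWord a as (proj₁ (proj₂ pα))))) (length-runs 0 αWord)
    evenCount : nu n β ≡ Σ signedWords g
    evenCount = trans (nu≡evenBelowCount n 2≤n β pβ) (cong (evenBelowCount n) (descentWord-fromDescentWord bs))
    subset-β : subsetᵇ (descentWord β) αWord ≡ subsetᵇ bs αWord
    subset-β = cong (λ z → subsetᵇ z αWord) (descentWord-fromDescentWord bs)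
    by-subset : ∀ b → subsetᵇ bs αWord ≡ b →
      ifℤ (isBelow? β) (sign ℤ.* + Σ signedWords g) ≡ Σℤ signedWords (λ w → möbiusSummand bs w)
    by-subset true eq = begin
        ifℤ (isBelow? β) (sign ℤ.* + Σ signedWords g)
      ≡⟨ ifℤ-yes (isBelow? β) _ (proj₂ (DesSet⊆⇔subsetᵇ n β (a ∷ as) pβ pα) (trans subset-β eq)) ⟩
        sign ℤ.* + Σ signedWords g
      ≡⟨ trans (cong (sign ℤ.*_) (pos-Σ signedWords g)) (sym (Σℤ-*ˡ signedWords sign (λ w → + g w))) ⟩
        Σℤ signedWords (λ w → sign ℤ.* + g w)
      ≡⟨ Σℤ-ext signedWords (λ w → summand (ind (isEvenSignedPerm? n w)) (subsetᵇ (descentBits n w) bs)) ⟩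
        Σℤ signedWords (λ w → möbiusSummand bs w) ∎
      where
      summand : ∀ i x → sign ℤ.* + (i * boolToℕ x) ≡ + i ℤ.* (if x B.∧ subsetᵇ bs αWord then sign else + 0)
      summand i true rewrite eq | ℕP.*-identityʳ i = ℤP.*-comm sign (+ i)
      summand i false = trans (cong (λ z → sign ℤ.* + z) (ℕP.*-zeroʳ i)) (trans (ℤP.*-zeroʳ sign) (sym (ℤP.*-zeroʳ (+ i))))
    by-subset false eq = begin
        ifℤ (isBelow? β) (sign ℤ.* + Σ signedWords g)
      ≡⟨ ifℤ-no (isBelow? β) _ (λ below → true≢false (trans (sym (trans (sym subset-β) (proj₁ (DesSet⊆⇔subsetᵇ n β (a ∷ as) pβ pα) below))) eq)) ⟩
        + 0
      ≡⟨ sym (Σℤ-zero signedWords) ⟩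
        Σℤ signedWords (λ w → + 0)
      ≡⟨ Σℤ-ext signedWords (λ w → sym (summand (ind (isEvenSignedPerm? n w)) (subsetᵇ (descentBits n w) bs))) ⟩
        Σℤ signedWords (λ w → möbiusSummand bs w) ∎
      where
      true≢false : true ≡ false → ⊥
      true≢false ()
      summand : ∀ i x → + i ℤ.* (if x B.∧ subsetᵇ bs αWord then sign else + 0) ≡ + 0
      summand i true rewrite eq = ℤP.*-zeroʳ (+ i)
      summand i false = ℤP.*-zeroʳ (+ i)

  Σ-möbiusSummand : Σℤ (allLists bools n) (λ bs → Σℤ signedWords (λ w → möbiusSummand bs w)) ≡
    + Σ signedWords (λ w → ind (isEvenSignedPerm? n w) * ind (descentBits n w ≟𝔹* descentWord (a ∷ as)))
  Σ-möbiusSummand = begin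
      Σℤ words (λ bs → Σℤ signedWords (λ w → möbiusSummand bs w))
    ≡⟨ Σℤ-swap words signedWords möbiusSummand ⟩
      Σℤ signedWords (λ w → Σℤ words (λ bs → möbiusSummand bs w))
    ≡⟨ Σℤ-ext signedWords (λ w → trans (Σℤ-*ˡ words (+ ind (isEvenSignedPerm? n w)) (möbiusTerm (descentBits n w) αWord))
         (cong (+ ind (isEvenSignedPerm? n w) ℤ.*_) (Σ-möbiusTerm n (descentBits n w) αWord (LP.length-applyUpTo _ n) (length-descentWord a as n pα)))) ⟩
      Σℤ signedWords (λ w → + ind (isEvenSignedPerm? n w) ℤ.* (if does (descentBits n w ≟𝔹* αWord) then + 1 else + 0))
    ≡⟨ Σℤ-ext signedWords (λ w → trans (cong (+ ind (isEvenSignedPerm? n w) ℤ.*_) (if-ind (descentBits n w ≟𝔹* αWord)))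
                                         (sym (ℤP.pos-* (ind (isEvenSignedPerm? n w)) _))) ⟩
      Σℤ signedWords (λ w → + (ind (isEvenSignedPerm? n w) * ind (descentBits n w ≟𝔹* αWord)))
    ≡⟨ sym (pos-Σ signedWords _) ⟩
      + Σ signedWords (λ w → ind (isEvenSignedPerm? n w) * ind (descentBits n w ≟𝔹* αWord)) ∎
    where
    open ≡-Reasoning
    words = allLists bools n
    αWord = descentWord (a ∷ as)
    if-ind : {P : Set} (p : Dec P) → (if does p then + 1 else + 0) ≡ + ind p
    if-ind (yes _) = refl
    if-ind (no _)  = refl

proposition5p1 : (n : ℕ) → 4 ≤ n → (α : List ℕ) → IsPseudoComposition n α →
    + rD n α ≡ rhs n α
proposition5p1 n 4≤n []       (() , _)
proposition5p1 n 4≤n (a ∷ as) pα =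
  trans (rD≡Σ-descentBits n a as pα)
  (trans (sym (Σ-möbiusSummand n a as pα))
  (trans (sym (Σℤ-allLists-cong bools n (rhsTerm≡Σ-möbiusSummand n a as pα (ℕP.≤-trans (s≤s (s≤s z≤n)) 4≤n))))
         (sym (rhs≡Σ-words n a as pα))))
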